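{- Let $S$ be a finite set of alternatives with $|S|\ge 3$, let $V=\{1,\dots,N\}$ be a finite set of voters, and let $f:\Pi_S^V\to\Pi_S$ be a social welfare function. Then $f$ satisfies Independence of Irrelevant Alternatives (IIA) and Citizens' Sovereignty (CS) if and only if either $f$ is null, or $f$ is dictatorial with some dictator $i$ and defers over $i$ to some clerical-dictatorial function $g:\Pi_S^{V\setminus\{i\}}\to\Pi_S$.
   Context: $\Pi_S$ denotes the set of complete transitive binary relations (weak preferences) on $S$; for $R\in\Pi_S$ we write $x\le_R y$ for $(x,y)\in R$, and $x<_R y$, $x=_R y$ have the obvious meanings. A configuration is ${\bf R}=(R_1,\dots,R_N)\in\Pi_S^V$. A social welfare function (SWF) is any map $f:\Pi_S^V\to\Pi_S$ (for any finite voter set $V$, possibly empty). IIA: whenever ${\bf P},{\bf Q}\in\Pi_S^V$ agree (for every voter) on the pair $\{x,y\}$, $f({\bf P})$ and $f({\bf Q})$ agree on $\{x,y\}$. CS: for every pair $x,y\in S$ there exist configurations ${\bf P},{\bf Q}$ with $x\le_{f({\bf P})}y$ and $y\le_{f({\bf Q})}x$. $f$ is null if $x=_{f({\bf R})}y$ for all ${\bf R}$ and all $x,y$. $f$ is dictatorial with dictator $i$ if either for all $x,y,{\bf R}$: $x\le_{f({\bf R})}y\Rightarrow x\le_{R_i}y$, or for all $x,y,{\bf R}$: $x\le_{f({\bf R})}y\Rightarrow y\le_{R_i}x$. For ${\bf R}\in\Pi_S^V$, ${\bf R}_{ -i}\in\Pi_S^{V\setminus\{i\}}$ is its restriction to voters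 other than $i$. A dictatorial $f$ with dictator $i$ defers to $g:\Pi_S^{V\setminus\{i\}}\to\Pi_S$ over $i$ if for all $x,y\in S$ and ${\bf R}$ with $x=_{R_i}y$: $x\le_{f({\bf R})}y\iff x\le_{g({\bf R}_{ -i})}y$. $f$ is clerical with cleric $C\in\Pi_S$ if for all $x,y,{\bf R}$: $x\le_{f({\bf R})}y\Rightarrow x\le_C y$. For $A\subseteq S$, the restriction $f|_A:\Pi_A^V\to\Pi_A$ is defined by: given ${\bf R}\in\Pi_A^V$ pick any ${\bf R}'\in\Pi_S^V$ agreeing with ${\bf R}$ on all pairs in $A$, and set $x\le_{f|_A({\bf R})}y$ iff $x\le_{f({\bf R}')}y$ for $x,y\in A$; $f|_A$ is well defined if this does not depend on the choice of ${\bf R}'$. Clerical-dictatorial (recursive definition): $f:\Pi_S^V\to\Pi_S$ is clerical-dictatorial if it is null, or $|S|\le 2$, or there is a cleric $C\in\Pi_S$ such that (1) $f$ is clerical with cleric $C$, and (2) for every equivalence class $A$ of $C$: (a) $f|_A$ is well defined and is null, dictatorial, or $|A|=2$; (b) if $f|_A$ is dictatorial (with dictator $j$) then it defers over $j$ to a clerical-dictatorial function $\Pi_A^{V\setminus\{j\}}\to\Pi_A$. -}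

module Defs where

open import Data.Bool using (Bool; true; false; T; _∧_)
open import Data.Bool.Properties using (T?)
open import Data.Unit using (tt)
open import Data.Empty using (⊥; ⊥-elim)
open import Data.Sum using (_⊎_; inj₁; inj₂)
open import Data.Product using (Σ; _×_; _,_; proj₁; proj₂)
open import Relation.Nullary using (¬_; Dec; yes; no)
open import Relation.Binary.PropositionalEquality using (_≡_; _≢_)

-- Weak preferences Π_S: complete, transitive relations on S.
-- (x ≤_R y) is represented by  T (rel R x y).

record Pref (S : Set) : Set where
  field
    rel   : S → S → Bool
    total : ∀ x y → T (rel x y) ⊎ T (rel y x)
    trans : ∀ x y z → T (rel x y) → T (rel y z) → T (rel x z)
open Pref public

Config : Set → Set → Set
Config S V = V → Pref S

SWF : Set → Set → Set
SWF S V = Config S V → Pref S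

_∖_ : (V : Set) → V → Set
V ∖ i = Σ V (λ k → k ≢ i)

drop : ∀ {S V} (i : V) → Config S V → Config S (V ∖ i)
drop i R k = R (proj₁ k)

IIA : ∀ {S V} → SWF S V → Set
IIA {S} {V} f = ∀ (x y : S) (P Q : Config S V) →
  (∀ v → (rel (P v) x y ≡ rel (Q v) x y) × (rel (P v) y x ≡ rel (Q v) y x)) →
  (rel (f P) x y ≡ rel (f Q) x y) × (rel (f P) y x ≡ rel (f Q) y x)

CS : ∀ {S V} → SWF S V → Set
CS {S} {V} f = ∀ (x y : S) →
  Σ (Config S V) (λ P → T (rel (f P) x y)) × Σ (Config S V) (λ Q → T (rel (f Q) y x))

Null : ∀ {S V} → SWF S V → Set
Null {S} {V} f = ∀ (R : Config S V) (x y : S) → T (rel (f R) x y)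

Dictatorial : ∀ {S V} → SWF S V → V → Set
Dictatorial {S} {V} f i =
    (∀ (x y : S) (R : Config S V) → T (rel (f R) x y) → T (rel (R i) x y))
  ⊎ (∀ (x y : S) (R : Config S V) → T (rel (f R) x y) → T (rel (R i) y x))

Defers : ∀ {S V} → SWF S V → (i : V) → SWF S (V ∖ i) → Set
Defers {S} {V} f i g = ∀ (x y : S) (R : Config S V) →
  T (rel (R i) x y) → T (rel (R i) y x) →
  rel (f R) x y ≡ rel (g (drop i R)) x y

Clerical : ∀ {S V} → SWF S V → Pref S → Set
Clerical {S} {V} f C = ∀ (x y : S) (R : Config S V) → T (rel (f R) x y) → T (rel C x y)

AtMostTwo : Set → Set
AtMostTwo S = ∀ (x y z : S) → x ≡ y ⊎ y ≡ z ⊎ x ≡ z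

ExactlyTwo : Set → Set
ExactlyTwo S = Σ S λ a → Σ S λ b → a ≢ b × (∀ c → c ≡ a ⊎ c ≡ b)

Sub : {S : Set} → (S → Bool) → Set
Sub {S} p = Σ S (λ x → T (p x))

classOf : ∀ {S} → Pref S → S → (S → Bool)
classOf C x y = rel C y x ∧ rel C x y

restrict : ∀ {S} (p : S → Bool) → Pref S → Pref (Sub p)
rel   (restrict p R) a b = rel R (proj₁ a) (proj₁ b)
total (restrict p R) a b = total R (proj₁ a) (proj₁ b)
trans (restrict p R) a b c = trans R (proj₁ a) (proj₁ b) (proj₁ c)

-- a fixed extension of a preference on A to S (elements outside A
-- are placed on top, all tied); used to compute f|_A when it is well defined
module _ {S : Set} (p : S → Bool) (R : Pref (Sub p)) where
  private
    aux : ∀ {x y : S} → Dec (T (p x)) → Dec (T (p y)) → Bool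
    aux {x} {y} (yes a) (yes b) = rel R (x , a) (y , b)
    aux         (yes _) (no _)  = true
    aux         (no _)  (yes _) = false
    aux         (no _)  (no _)  = true

    erel : S → S → Bool
    erel x y = aux (T? (p x)) (T? (p y))

    etotal : ∀ x y → T (erel x y) ⊎ T (erel y x)
    etotal x y with T? (p x) | T? (p y)
    ... | yes a | yes b = total R (x , a) (y , b)
    ... | yes _ | no _  = inj₁ tt
    ... | no _  | yes _ = inj₂ tt
    ... | no _  | no _  = inj₁ tt

    etrans : ∀ x y z → T (erel x y) → T (erel y z) → T (erel x z)
    etrans x y z h1 h2 with T? (p x) | T? (p y) | T? (p z)
    ... | yes _ | yes _ | no _  = tt
    ... | yes _ | no _  | no _  = tt
    ... | no _  | yes _ | no _  = tt
    ... | no _  | no _  | no _  = tt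
    ... | yes a | yes b | yes c = trans R (x , a) (y , b) (z , c) h1 h2
    ... | no _  | yes _ | yes _ = ⊥-elim h1
    ... | yes _ | no _  | yes _ = ⊥-elim h2
    ... | no _  | no _  | yes _ = ⊥-elim h2

  extend : Pref S
  rel extend = erel
  total extend = etotal
  trans extend = etrans

WellDefinedOn : ∀ {S V} → SWF S V → (S → Bool) → Set
WellDefinedOn {S} {V} f p = ∀ (P Q : Config S V) →
  (∀ v (a b : Sub p) → rel (P v) (proj₁ a) (proj₁ b) ≡ rel (Q v) (proj₁ a) (proj₁ b)) →
  ∀ (a b : Sub p) → rel (f P) (proj₁ a) (proj₁ b) ≡ rel (f Q) (proj₁ a) (proj₁ b)

restrictSWF : ∀ {S V} → SWF S V → (p : S → Bool) → SWF (Sub p) V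
restrictSWF f p R = restrict p (f (λ v → extend p (R v)))

-- Clerical-dictatorial functions (inductive = the paper's well-founded
-- recursive definition)

data ClericalDictatorial : (S V : Set) → SWF S V → Set₁ where
  cd-null  : ∀ {S V} {f : SWF S V} → Null f → ClericalDictatorial S V f
  cd-small : ∀ {S V} {f : SWF S V} → AtMostTwo S → ClericalDictatorial S V f
  cd-cleric : ∀ {S V} {f : SWF S V} (C : Pref S) →
    Clerical f C →
    (∀ (x : S) →
        WellDefinedOn f (classOf C x)
      × (Null (restrictSWF f (classOf C x))
         ⊎ Σ V (λ j → Dictatorial (restrictSWF f (classOf C x)) j)
         ⊎ ExactlyTwo (Sub (classOf C x)))
      × (∀ (j : V) → Dictatorial (restrictSWF f (classOf C x)) j →
           Σ (SWF (Sub (classOf C x)) (V ∖ j)) λ g →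
               Defers (restrictSWF f (classOf C x)) j g
             × ClericalDictatorial (Sub (classOf C x)) (V ∖ j) g)) →
    ClericalDictatorial S V f

-- By Wilson's theorem (Arrow's argument without Pareto), an IIA and CS function on three or more
-- alternatives is null, dictatorial or anti-dictatorial.  A dictator i leaves open only the pairs
-- i is indifferent about, and on those, by IIA, f agrees with the function of the other voters
-- obtained by making i indifferent between everything.  That function is IIA, and every IIA function
-- is clerical-dictatorial: its cleric puts x weakly below y when some profile does, on each class
-- of the cleric CS holds, so Wilson's theorem applies to classes of three or more alternatives, and
-- the dictator of a class again defers to an IIA function of one voter fewer.  Conversely, IIA
-- passes up the recursive definition of clerical-dictatorial functions.

module Submission where

open import Defs
open import Data.Bool using (Bool; true; false; T; _∧_; _∨_; not; if_then_else_)
open import Data.Bool.Properties using (T?; T-irrelevant; T-∨; T-∧)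
open import Data.Empty using (⊥; ⊥-elim)
open import Data.Fin using (Fin; zero; suc; toℕ; fromℕ<)
import Data.Fin as Fin
open import Data.Fin.Properties using (toℕ<n; toℕ-fromℕ<; fromℕ<-toℕ)
open import Data.List using (List; []; _∷_; length; downFrom; allFin)
open import Data.List.Membership.Propositional.Properties using (∈-allFin)
open import Data.Bool.ListAction using (any)
open import Data.List.Membership.Propositional using (_∈_; _∉_; lose)
open import Data.List.Relation.Unary.Any using (here; there; any?; satisfied)
open import Data.List.Relation.Unary.Any.Properties using (any⁺; any⁻)
open import Data.Nat using (ℕ; zero; suc; _≤_; _<_; _≤ᵇ_; _≡ᵇ_; z≤n; s≤s)
open import Data.Nat.Properties using (≤ᵇ⇒≤; ≤⇒≤ᵇ; ≤-total; ≤-refl; ≤-trans; n≤1+n; 1+n≰n; <⇒≱; m≤n⇒m≤1+n; ≤∧≢⇒<; n<1+n; ≡ᵇ⇒≡; ≡⇒≡ᵇ) renaming (_≟_ to _≟ℕ_)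
open import Data.Product using (Σ; _×_; _,_; proj₁; proj₂; swap)
open import Data.Product.Properties using () renaming (≡-dec to ×-≡-dec)
open import Data.Sum using (_⊎_; inj₁; inj₂) renaming (map to map-⊎)
open import Data.Unit using (tt)
open import Function.Base using (_∘_)
open import Function.Bundles using (Equivalence; _⇔_; mk⇔)
open import Relation.Binary.Definitions using (DecidableEquality)
open import Relation.Binary.PropositionalEquality
  using (_≡_; _≢_; refl; sym; cong; cong₂; subst; subst₂; ≢-sym; module ≡-Reasoning) renaming (trans to ≡-trans)
open import Relation.Nullary using (¬_; yes; no; ¬?; _×-dec_)
open import Relation.Nullary.Decidable using (decidable-stable)

T⇒≡true : ∀ {b} → T b → b ≡ true
T⇒≡true {true} _ = refl

≡true⇒T : ∀ {b} → b ≡ true → T b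
≡true⇒T refl = tt

¬T⇒≡false : ∀ {b} → ¬ T b → b ≡ false
¬T⇒≡false {true}  ¬t = ⊥-elim (¬t tt)
¬T⇒≡false {false} _  = refl

≡false⇒¬T : ∀ {b} → b ≡ false → ¬ T b
≡false⇒¬T refl ()

T-injective : ∀ {a b} → (T a → T b) → (T b → T a) → a ≡ b
T-injective {true}  {true}  _ _ = refl
T-injective {true}  {false} f _ = ⊥-elim (f tt)
T-injective {false} {true}  _ g = ⊥-elim (g tt)
T-injective {false} {false} _ _ = refl

module _ {S : Set} where

  rel-refl : (P : Pref S) (x : S) → T (rel P x x)
  rel-refl P x with total P x x
  ... | inj₁ t = t
  ... | inj₂ t = t

  rel-false⇒flip : (P : Pref S) (x y : S) → rel P x y ≡ false → T (rel P y x)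
  rel-false⇒flip P x y ¬xy with total P x y
  ... | inj₁ t = ⊥-elim (≡false⇒¬T ¬xy t)
  ... | inj₂ t = t

  record Agree (x y : S) (P Q : Pref S) : Set where
    constructor _,_
    field
      ≡xy : rel P x y ≡ rel Q x y
      ≡yx : rel P y x ≡ rel Q y x
  open Agree public

  agree-refl : ∀ {x y P} → Agree x y P P
  agree-refl = refl , refl

  agree-sym : ∀ {x y P Q} → Agree x y P Q → Agree x y Q P
  agree-sym (e₁ , e₂) = sym e₁ , sym e₂

  agree-swap : ∀ {x y P Q} → Agree x y P Q → Agree y x P Q
  agree-swap (e₁ , e₂) = e₂ , e₁

  agree-diag : ∀ {x} (P Q : Pref S) → Agree x x P Q
  agree-diag {x} P Q = e , e
    where e = ≡-trans (T⇒≡true (rel-refl P x)) (sym (T⇒≡true (rel-refl Q x)))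

  agree-≡ : ∀ {x y P Q} → P ≡ Q → Agree x y P Q
  agree-≡ refl = agree-refl

  agree-transport : ∀ {x y P Q} → Agree x y P Q → T (rel Q x y) → T (rel P x y)
  agree-transport (e , _) t = ≡true⇒T (≡-trans e (T⇒≡true t))

  agree-false : (P Q : Pref S) (x y : S) → rel P x y ≡ false → rel Q x y ≡ false → Agree x y P Q
  agree-false P Q x y e₁ e₂ =
    ≡-trans e₁ (sym e₂) ,
    ≡-trans (T⇒≡true (rel-false⇒flip P x y e₁)) (sym (T⇒≡true (rel-false⇒flip Q x y e₂)))

  record _<⟨_⟩_ (x : S) (P : Pref S) (y : S) : Set where
    constructor mk<
    field
      ≰ : rel P y x ≡ false
  open _<⟨_⟩_ public

  <⇒rel : ∀ {P x y} → x <⟨ P ⟩ y → T (rel P x y)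
  <⇒rel {P} {x} {y} (mk< e) = rel-false⇒flip P y x e

  <-trans : ∀ {P x y z} → x <⟨ P ⟩ y → y <⟨ P ⟩ z → x <⟨ P ⟩ z
  <-trans {P} {x} {y} {z} x<y y<z =
    mk< (¬T⇒≡false λ zx → ≡false⇒¬T (≰ x<y) (trans P y z x (<⇒rel y<z) zx))

  <-agree : ∀ {P Q x y} → x <⟨ P ⟩ y → x <⟨ Q ⟩ y → Agree x y P Q
  <-agree {P} {Q} x<y x<y′ =
    ≡-trans (T⇒≡true (<⇒rel x<y)) (sym (T⇒≡true (<⇒rel x<y′))) , ≡-trans (≰ x<y) (sym (≰ x<y′))

  <-transport : ∀ {P Q x y} → Agree x y P Q → x <⟨ Q ⟩ y → x <⟨ P ⟩ y
  <-transport (_ , e) (mk< e′) = mk< (≡-trans e e′)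

  ¬<-both : ∀ {P x y} → x <⟨ P ⟩ y → y <⟨ P ⟩ x → ⊥
  ¬<-both {P} {x} {y} x<y y<x = ≡false⇒¬T (≰ y<x) (<⇒rel x<y)

  Indifferent : Pref S → S → S → Set
  Indifferent P x y = (rel P x y ≡ true) × (rel P y x ≡ true)

  indifferent-agree : ∀ {P Q x y} → Agree x y P Q → Indifferent Q x y → Indifferent P x y
  indifferent-agree (e₁ , e₂) (i₁ , i₂) = ≡-trans e₁ i₁ , ≡-trans e₂ i₂

  indifferent-left : (P : Pref S) {x y : S} (z : S) → Indifferent P x y → rel P x z ≡ rel P y z
  indifferent-left P {x} {y} z (e₁ , e₂) =
    T-injective (trans P y x z (≡true⇒T e₂)) (trans P x y z (≡true⇒T e₁))

  indifferent-right : (P : Pref S) {x y : S} (z : S) → Indifferent P x y → rel P z x ≡ rel P z y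
  indifferent-right P {x} {y} z (e₁ , e₂) =
    T-injective (λ t → trans P z x y t (≡true⇒T e₁)) (λ t → trans P z y x t (≡true⇒T e₂))

  rank : (S → ℕ) → Pref S
  rel   (rank r) x y = r x ≤ᵇ r y
  total (rank r) x y with ≤-total (r x) (r y)
  ... | inj₁ le = inj₁ (≤⇒≤ᵇ le)
  ... | inj₂ ge = inj₂ (≤⇒≤ᵇ ge)
  trans (rank r) x y z t₁ t₂ = ≤⇒≤ᵇ (≤-trans (≤ᵇ⇒≤ (r x) (r y) t₁) (≤ᵇ⇒≤ (r y) (r z) t₂))

  indifference : Pref S
  rel   indifference _ _ = true
  total indifference _ _ = inj₁ tt
  trans indifference _ _ _ _ _ = tt

  indifferent⇒agree : ∀ {P x y} → Indifferent P x y → Agree x y P indifference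
  indifferent⇒agree (e₁ , e₂) = e₁ , e₂

  reverse : Pref S → Pref S
  rel   (reverse P) x y = rel P y x
  total (reverse P) x y = total P y x
  trans (reverse P) x y z t₁ t₂ = trans P z y x t₂ t₁

  agree-reverse : ∀ {x y P Q} → Agree y x P Q → Agree x y (reverse P) (reverse Q)
  agree-reverse (e₁ , e₂) = e₁ , e₂

reverseSWF : ∀ {S V} → SWF S V → SWF S V
reverseSWF f R = reverse (f R)

<⇒≤ᵇ≡false : ∀ {m n} → n < m → (m ≤ᵇ n) ≡ false
<⇒≤ᵇ≡false {m} {n} n<m = ¬T⇒≡false (λ t → <⇒≱ n<m (≤ᵇ⇒≤ m n t))

module Profiles {S : Set} (_≟_ : DecidableEquality S) where

  _[_≔_] : (S → ℕ) → S → ℕ → S → ℕ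
  (r [ x ≔ n ]) s with s ≟ x
  ... | yes _ = n
  ... | no  _ = r s

  ≔-hit : ∀ r x n → (r [ x ≔ n ]) x ≡ n
  ≔-hit r x n with x ≟ x
  ... | yes _ = refl
  ... | no x≢x = ⊥-elim (x≢x refl)

  ≔-miss : ∀ r {x} n {s} → s ≢ x → (r [ x ≔ n ]) s ≡ r s
  ≔-miss r {x} n {s} s≢x with s ≟ x
  ... | yes s≡x = ⊥-elim (s≢x s≡x)
  ... | no  _   = refl

  rel-rank : (r : S → ℕ) (u w : S) {m n : ℕ} → r u ≡ m → r w ≡ n → rel (rank r) u w ≡ (m ≤ᵇ n)
  rel-rank r u w refl refl = refl

  bottom : S → Pref S
  bottom x = rank ((λ _ → 1) [ x ≔ 0 ])

  bottom-< : ∀ {x y} → x ≢ y → x <⟨ bottom x ⟩ y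
  bottom-< {x} {y} x≢y = mk< (rel-rank ((λ _ → 1) [ x ≔ 0 ]) y x (≔-miss (λ _ → 1) 0 (≢-sym x≢y)) (≔-hit (λ _ → 1) x 0))

  some-pref-disagrees : ∀ {u w} → u ≢ w → ¬ (∀ X → T (rel X u w))
  some-pref-disagrees {u} {w} u≢w all = ≡false⇒¬T (≰ (bottom-< (≢-sym u≢w))) (all (bottom w))

  ranks₃ : S → S → S → ℕ → ℕ → ℕ → Pref S
  ranks₃ x y z l m n = rank ((((λ _ → 0) [ z ≔ n ]) [ y ≔ m ]) [ x ≔ l ])

  module Ranks₃ {x y z : S} (x≢y : x ≢ y) (x≢z : x ≢ z) (y≢z : y ≢ z) (l m n : ℕ) where
    private
      r : S → ℕ
      r = (((λ _ → 0) [ z ≔ n ]) [ y ≔ m ]) [ x ≔ l ]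
      r-x : r x ≡ l
      r-x = ≔-hit _ x l
      r-y : r y ≡ m
      r-y = ≡-trans (≔-miss _ l (≢-sym x≢y)) (≔-hit _ y m)
      r-z : r z ≡ n
      r-z = ≡-trans (≔-miss _ l (≢-sym x≢z)) (≡-trans (≔-miss _ m (≢-sym y≢z)) (≔-hit _ z n))

    at-xy : rel (ranks₃ x y z l m n) x y ≡ (l ≤ᵇ m)
    at-xy = rel-rank r x y r-x r-y
    at-yx : rel (ranks₃ x y z l m n) y x ≡ (m ≤ᵇ l)
    at-yx = rel-rank r y x r-y r-x
    at-xz : rel (ranks₃ x y z l m n) x z ≡ (l ≤ᵇ n)
    at-xz = rel-rank r x z r-x r-z
    at-zx : rel (ranks₃ x y z l m n) z x ≡ (n ≤ᵇ l)
    at-zx = rel-rank r z x r-z r-x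
    at-yz : rel (ranks₃ x y z l m n) y z ≡ (m ≤ᵇ n)
    at-yz = rel-rank r y z r-y r-z
    at-zy : rel (ranks₃ x y z l m n) z y ≡ (n ≤ᵇ m)
    at-zy = rel-rank r z y r-z r-y

  pairRank : ℕ → Pref S → S → S → ℕ
  pairRank n P u w = if rel P u w then n else suc n

  pairRank-≤ᵇ : ∀ n P u w → (pairRank n P u w ≤ᵇ pairRank n P w u) ≡ rel P u w
  pairRank-≤ᵇ n P u w with rel P u w | rel P w u | total P u w
  ... | true  | true  | _ = T⇒≡true (≤⇒≤ᵇ (≤-refl {n}))
  ... | true  | false | _ = T⇒≡true (≤⇒≤ᵇ (n≤1+n n))
  ... | false | true  | _ = ¬T⇒≡false (λ t → 1+n≰n (≤ᵇ⇒≤ (suc n) n t))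
  ... | false | false | inj₁ ()
  ... | false | false | inj₂ ()

  pairRank-lower : ∀ n P u w → n ≤ pairRank n P u w
  pairRank-lower n P u w with rel P u w
  ... | true  = ≤-refl
  ... | false = n≤1+n n

  pairRank-upper : ∀ n P u w → pairRank n P u w ≤ suc n
  pairRank-upper n P u w with rel P u w
  ... | true  = n≤1+n n
  ... | false = ≤-refl

  below : S → S → S → Pref S → Pref S
  below e u w P = ranks₃ e u w 0 (pairRank 1 P u w) (pairRank 1 P w u)

  above : S → S → S → Pref S → Pref S
  above e u w P = ranks₃ e u w 2 (pairRank 0 P u w) (pairRank 0 P w u)

  module Placed {e u w : S} (e≢u : e ≢ u) (e≢w : e ≢ w) (u≢w : u ≢ w) (P : Pref S) where
    below-agree : Agree u w (below e u w P) P
    below-agree = ≡-trans (Ranks₃.at-yz e≢u e≢w u≢w 0 _ _) (pairRank-≤ᵇ 1 P u w)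
                , ≡-trans (Ranks₃.at-zy e≢u e≢w u≢w 0 _ _) (pairRank-≤ᵇ 1 P w u)
    below-<₁ : e <⟨ below e u w P ⟩ u
    below-<₁ = mk< (≡-trans (Ranks₃.at-yx e≢u e≢w u≢w 0 _ _) (<⇒≤ᵇ≡false (pairRank-lower 1 P u w)))
    below-<₂ : e <⟨ below e u w P ⟩ w
    below-<₂ = mk< (≡-trans (Ranks₃.at-zx e≢u e≢w u≢w 0 _ _) (<⇒≤ᵇ≡false (pairRank-lower 1 P w u)))
    above-agree : Agree u w (above e u w P) P
    above-agree = ≡-trans (Ranks₃.at-yz e≢u e≢w u≢w 2 _ _) (pairRank-≤ᵇ 0 P u w)
                , ≡-trans (Ranks₃.at-zy e≢u e≢w u≢w 2 _ _) (pairRank-≤ᵇ 0 P w u)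
    above-<₁ : u <⟨ above e u w P ⟩ e
    above-<₁ = mk< (≡-trans (Ranks₃.at-xy e≢u e≢w u≢w 2 _ _) (<⇒≤ᵇ≡false (s≤s (pairRank-upper 0 P u w))))
    above-<₂ : w <⟨ above e u w P ⟩ e
    above-<₂ = mk< (≡-trans (Ranks₃.at-xz e≢u e≢w u≢w 2 _ _) (<⇒≤ᵇ≡false (s≤s (pairRank-upper 0 P w u))))

  third : ∀ {a b c} → a ≢ b → a ≢ c → b ≢ c → (u w : S) → Σ S (λ v → v ≢ u × v ≢ w)
  third {a} {b} {c} a≢b a≢c b≢c u w with a ≟ u | a ≟ w | b ≟ u | b ≟ w
  ... | no a≢u | no a≢w | _ | _ = a , a≢u , a≢w
  ... | _ | _ | no b≢u | no b≢w = b , b≢u , b≢w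
  ... | yes refl | _ | yes refl | _ = ⊥-elim (a≢b refl)
  ... | _ | yes refl | _ | yes refl = ⊥-elim (a≢b refl)
  ... | yes refl | _ | no _ | yes refl = c , ≢-sym a≢c , ≢-sym b≢c
  ... | no _ | yes refl | yes refl | _ = c , ≢-sym b≢c , ≢-sym a≢c

_∈ᵇ_ : ℕ → List ℕ → Bool
k ∈ᵇ []       = false
k ∈ᵇ (m ∷ ms) = (k ≡ᵇ m) ∨ (k ∈ᵇ ms)

≡ᵇ-refl : ∀ k → T (k ≡ᵇ k)
≡ᵇ-refl k = ≡⇒≡ᵇ k k refl

≡ᵇ-false⇒≢ : ∀ {m n} → (m ≡ᵇ n) ≡ false → m ≢ n
≡ᵇ-false⇒≢ {m} e refl = ≡false⇒¬T e (≡ᵇ-refl m)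

∈ᵇ-here : ∀ k ms → T (k ∈ᵇ (k ∷ ms))
∈ᵇ-here k ms = Equivalence.from T-∨ (inj₁ (≡ᵇ-refl k))

∈ᵇ-there : ∀ k m ms → T (k ∈ᵇ ms) → T (k ∈ᵇ (m ∷ ms))
∈ᵇ-there k m ms t = Equivalence.from (T-∨ {k ≡ᵇ m}) (inj₂ t)

∈ᵇ-∷ : ∀ k m ms → T (k ∈ᵇ (m ∷ ms)) → k ≡ m ⊎ T (k ∈ᵇ ms)
∈ᵇ-∷ k m ms t with Equivalence.to (T-∨ {k ≡ᵇ m}) t
... | inj₁ k≡m = inj₁ (≡ᵇ⇒≡ k m k≡m)
... | inj₂ k∈ms = inj₂ k∈ms

IIAOn : ∀ {S} → List ℕ → SWF S ℕ → Set
IIAOn {S} ks G = ∀ (x y : S) (ρ σ : Config S ℕ) →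
  (∀ k → T (k ∈ᵇ ks) → Agree x y (ρ k) (σ k)) → Agree x y (G ρ) (G σ)

iiaOn-all : ∀ {S ks} {G : SWF S ℕ} → IIAOn ks G →
            ∀ {x y} ρ σ → (∀ k → Agree x y (ρ k) (σ k)) → Agree x y (G ρ) (G σ)
iiaOn-all iia {x} {y} ρ σ agree = iia x y ρ σ (λ k _ → agree k)

iiaOn-reverse : ∀ {S ks} {G : SWF S ℕ} → IIAOn ks G → IIAOn ks (reverseSWF G)
iiaOn-reverse iia x y ρ σ agree = agree-reverse (agree-swap (iia x y ρ σ agree))

Dictator : ∀ {S V} → SWF S V → V → Set
Dictator {S} {V} f i = ∀ (x y : S) (R : Config S V) → T (rel (f R) x y) → T (rel (R i) x y)

-- Arrow's theorem

module Arrow {S : Set} (_≟_ : DecidableEquality S) {a b c : S} (a≢b : a ≢ b) (a≢c : a ≢ c) (b≢c : b ≢ c)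
  (ks : List ℕ) (G : SWF S ℕ) (iia : IIAOn ks G)
  (pareto : ∀ {x y} → x ≢ y → x <⟨ G (λ _ → Profiles.bottom _≟_ x) ⟩ y) where
  open Profiles _≟_

  iia-all : ∀ {x y} ρ σ → (∀ k → Agree x y (ρ k) (σ k)) → Agree x y (G ρ) (G σ)
  iia-all = iiaOn-all {ks = ks} iia

  Decides : (ℕ → Bool) → S → S → Set
  Decides E x y = ∀ ρ → (∀ k → T (E k) → x <⟨ ρ k ⟩ y) → x <⟨ G ρ ⟩ y

  Decisive : (ℕ → Bool) → Set
  Decisive E = ∀ {x y} → x ≢ y → Decides E x y

  Split : (ℕ → Bool) → S → S → Config S ℕ → Set
  Split E x y ρ = ∀ k → (T (E k) → x <⟨ ρ k ⟩ y) × (¬ T (E k) → y <⟨ ρ k ⟩ x)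

  AlmostDecides : (ℕ → Bool) → S → S → Set
  AlmostDecides E x y = ∀ ρ → Split E x y ρ → x <⟨ G ρ ⟩ y

  decides⇒almost : ∀ {E x y} → Decides E x y → AlmostDecides E x y
  decides⇒almost decides ρ split = decides ρ (λ k → proj₁ (split k))

  almost-from-one : ∀ {E x y} ρ₀ → Split E x y ρ₀ → x <⟨ G ρ₀ ⟩ y → AlmostDecides E x y
  almost-from-one {E} {x} {y} ρ₀ split₀ x<y ρ split = <-transport (iia-all ρ ρ₀ agree) x<y
    where
      agree : ∀ k → Agree x y (ρ k) (ρ₀ k)
      agree k with T? (E k)
      ... | yes e = <-agree (proj₁ (split k) e) (proj₁ (split₀ k) e)
      ... | no ¬e = agree-swap (<-agree (proj₂ (split k) ¬e) (proj₂ (split₀ k) ¬e))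

  decisive-⊆ : ∀ {E F} → (∀ k → T (E k) → T (F k)) → Decisive E → Decisive F
  decisive-⊆ E⊆F decisive x≢y ρ unanimous = decisive x≢y ρ (λ k e → unanimous k (E⊆F k e))

  decisive-ks : Decisive (_∈ᵇ ks)
  decisive-ks {x} {y} x≢y ρ unanimous =
    <-transport (iia x y ρ (λ _ → bottom x) (λ k k∈ks → <-agree (unanimous k k∈ks) (bottom-< x≢y)))
                (pareto x≢y)

  unanimity : ∀ {x y} → x ≢ y → ∀ ρ → (∀ k → x <⟨ ρ k ⟩ y) → x <⟨ G ρ ⟩ y
  unanimity x≢y ρ unanimous = decisive-ks x≢y ρ (λ k _ → unanimous k)

  module FieldExpansion {E : ℕ → Bool} where

    -- Voters outside E put w lowest; unanimity then gives w < v.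
    expand-right : ∀ {u w v} → u ≢ w → v ≢ u → v ≢ w → AlmostDecides E u w → Decides E u v
    expand-right {u} {w} {v} u≢w v≢u v≢w almost ρ u<v = <-transport (iia-all ρ ρ′ agree-uv) (<-trans u<w (unanimity (≢-sym v≢w) ρ′ w<v))
      where
        module R = Ranks₃ u≢w (≢-sym v≢u) (≢-sym v≢w) 0 1 2
        module B (k : ℕ) = Placed (≢-sym u≢w) (≢-sym v≢w) (≢-sym v≢u) (ρ k)
        ρ′ : Config S ℕ
        ρ′ k = if E k then ranks₃ u w v 0 1 2 else below w u v (ρ k)
        agree-uv : ∀ k → Agree u v (ρ k) (ρ′ k)
        agree-uv k with E k | u<v k
        ... | true  | u<v-k = <-agree (u<v-k tt) (mk< R.at-zx)
        ... | false | _     = agree-sym (B.below-agree k)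
        split : Split E u w ρ′
        split k with E k
        ... | true  = (λ _ → mk< R.at-yx) , (λ ¬e → ⊥-elim (¬e tt))
        ... | false = (λ ()) , (λ _ → B.below-<₁ k)
        w<v : ∀ k → w <⟨ ρ′ k ⟩ v
        w<v k with E k
        ... | true  = mk< R.at-zy
        ... | false = B.below-<₂ k
        u<w : u <⟨ G ρ′ ⟩ w
        u<w = almost ρ′ split

    -- Voters outside E put u highest; unanimity then gives v < u.
    expand-left : ∀ {u w v} → u ≢ w → v ≢ u → v ≢ w → AlmostDecides E u w → Decides E v w
    expand-left {u} {w} {v} u≢w v≢u v≢w almost ρ v<w = <-transport (iia-all ρ ρ′ agree-vw) (<-trans (unanimity v≢u ρ′ v<u) u<w)
      where
        module R = Ranks₃ v≢u v≢w u≢w 0 1 2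
        module A (k : ℕ) = Placed (≢-sym v≢u) u≢w v≢w (ρ k)
        ρ′ : Config S ℕ
        ρ′ k = if E k then ranks₃ v u w 0 1 2 else above u v w (ρ k)
        agree-vw : ∀ k → Agree v w (ρ k) (ρ′ k)
        agree-vw k with E k | v<w k
        ... | true  | v<w-k = <-agree (v<w-k tt) (mk< R.at-zx)
        ... | false | _     = agree-sym (A.above-agree k)
        split : Split E u w ρ′
        split k with E k
        ... | true  = (λ _ → mk< R.at-zy) , (λ ¬e → ⊥-elim (¬e tt))
        ... | false = (λ ()) , (λ _ → A.above-<₂ k)
        v<u : ∀ k → v <⟨ ρ′ k ⟩ u
        v<u k with E k
        ... | true  = mk< R.at-yx
        ... | false = A.above-<₁ k
        u<w : u <⟨ G ρ′ ⟩ w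
        u<w = almost ρ′ split

    module _ {u w : S} (u≢w : u ≢ w) (almost : AlmostDecides E u w) where
      private
        v : S
        v = proj₁ (third a≢b a≢c b≢c u w)
        v≢u : v ≢ u
        v≢u = proj₁ (proj₂ (third a≢b a≢c b≢c u w))
        v≢w : v ≢ w
        v≢w = proj₂ (proj₂ (third a≢b a≢c b≢c u w))
        u⇒v : Decides E u v
        u⇒v = expand-right u≢w v≢u v≢w almost

      almost⇒decisive : Decisive E
      almost⇒decisive {x} {y} x≢y with x ≟ u | y ≟ w | y ≟ u | x ≟ w
      ... | yes refl | yes refl | _ | _ =
        expand-right (≢-sym v≢u) (≢-sym u≢w) (≢-sym v≢w) (decides⇒almost u⇒v)
      ... | yes refl | no y≢w | _ | _ = expand-right u≢w (≢-sym x≢y) y≢w almost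
      ... | no x≢u | yes refl | _ | _ = expand-left u≢w x≢u x≢y almost
      ... | no _ | no _ | yes refl | yes refl =
        expand-right (≢-sym v≢w) u≢w (≢-sym v≢u)
          (decides⇒almost (expand-left (≢-sym v≢u) (≢-sym u≢w) (≢-sym v≢w) (decides⇒almost u⇒v)))
      ... | no x≢u | no _ | yes refl | no x≢w =
        expand-right x≢w (≢-sym x≢u) u≢w (decides⇒almost (expand-left u≢w x≢u x≢w almost))
      ... | no _ | no y≢w | no y≢u | yes refl =
        expand-left (≢-sym y≢u) (≢-sym u≢w) (≢-sym y≢w) (decides⇒almost (expand-right u≢w y≢u y≢w almost))
      ... | no x≢u | no y≢w | no y≢u | no _ =
        expand-left (≢-sym y≢u) x≢u x≢y (decides⇒almost (expand-right u≢w y≢u y≢w almost))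

  open FieldExpansion using (almost⇒decisive)

  -- The three Condorcet orders a < b < c, c < a < b and b < c < a.
  condorcet : Bool → Bool → Pref S
  condorcet true  _     = ranks₃ a b c 0 1 2
  condorcet false true  = ranks₃ a b c 1 2 0
  condorcet false false = ranks₃ a b c 2 0 1

  condorcet-ab : ∀ b₁ b₂ → T (b₁ ∨ b₂) → a <⟨ condorcet b₁ b₂ ⟩ b
  condorcet-ab true  _    _ = mk< (Ranks₃.at-yx a≢b a≢c b≢c 0 1 2)
  condorcet-ab false true _ = mk< (Ranks₃.at-yx a≢b a≢c b≢c 1 2 0)

  condorcet-cb : ∀ b₁ b₂ → (T (not b₁ ∧ b₂) → c <⟨ condorcet b₁ b₂ ⟩ b) × (¬ T (not b₁ ∧ b₂) → b <⟨ condorcet b₁ b₂ ⟩ c)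
  condorcet-cb true  _     = (λ ()) , (λ _ → mk< (Ranks₃.at-zy a≢b a≢c b≢c 0 1 2))
  condorcet-cb false true  = (λ _ → mk< (Ranks₃.at-yz a≢b a≢c b≢c 1 2 0)) , (λ ¬e → ⊥-elim (¬e tt))
  condorcet-cb false false = (λ ()) , (λ _ → mk< (Ranks₃.at-zy a≢b a≢c b≢c 2 0 1))

  condorcet-ac : ∀ b₁ b₂ → (T b₁ → a <⟨ condorcet b₁ b₂ ⟩ c) × (¬ T b₁ → c <⟨ condorcet b₁ b₂ ⟩ a)
  condorcet-ac true  _     = (λ _ → mk< (Ranks₃.at-zx a≢b a≢c b≢c 0 1 2)) , (λ ¬e → ⊥-elim (¬e tt))
  condorcet-ac false true  = (λ ()) , (λ _ → mk< (Ranks₃.at-xz a≢b a≢c b≢c 1 2 0))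
  condorcet-ac false false = (λ ()) , (λ _ → mk< (Ranks₃.at-xz a≢b a≢c b≢c 2 0 1))

  module _ (k₀ : ℕ) (D : List ℕ) where
    private
      ρ₀ : Config S ℕ
      ρ₀ k = condorcet (k ≡ᵇ k₀) (k ∈ᵇ D)

    contraction : Decisive (_∈ᵇ (k₀ ∷ D)) → Decisive (_≡ᵇ k₀) ⊎ Decisive (_∈ᵇ D)
    contraction decisive with T? (rel (G ρ₀) b c)
    ... | no b≰c = inj₂ (decisive-⊆ (λ k e → proj₂ (Equivalence.to (T-∧ {not (k ≡ᵇ k₀)}) e))
                          (almost⇒decisive (≢-sym b≢c)
                            (almost-from-one ρ₀ (λ k → condorcet-cb (k ≡ᵇ k₀) (k ∈ᵇ D)) (mk< (¬T⇒≡false b≰c)))))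
    ... | yes b≤c = inj₁ (almost⇒decisive a≢c (almost-from-one ρ₀ (λ k → condorcet-ac (k ≡ᵇ k₀) (k ∈ᵇ D)) a<c))
      where
        a<b : a <⟨ G ρ₀ ⟩ b
        a<b = decisive a≢b ρ₀ (λ k → condorcet-ab (k ≡ᵇ k₀) (k ∈ᵇ D))
        a<c : a <⟨ G ρ₀ ⟩ c
        a<c = mk< (¬T⇒≡false λ c≤a → ≡false⇒¬T (≰ a<b) (trans (G ρ₀) b c a b≤c c≤a))

  decisive-singleton : ∀ D → (∀ k → T (k ∈ᵇ D) → T (k ∈ᵇ ks)) → Decisive (_∈ᵇ D) →
                       Σ ℕ (λ k → T (k ∈ᵇ ks) × Decisive (_≡ᵇ k))
  decisive-singleton [] _ decisive =
    ⊥-elim (¬<-both (decisive a≢b (λ _ → indifference) (λ _ ()))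
                    (decisive (≢-sym a≢b) (λ _ → indifference) (λ _ ())))
  decisive-singleton (k₀ ∷ D) D⊆ks decisive with contraction k₀ D decisive
  ... | inj₁ decisive₀ = k₀ , D⊆ks k₀ (∈ᵇ-here k₀ D) , decisive₀
  ... | inj₂ decisive′ = decisive-singleton D (λ k k∈D → D⊆ks k (∈ᵇ-there k k₀ D k∈D)) decisive′

  decisive⇒dictator : ∀ k → Decisive (_≡ᵇ k) → Dictator G k
  decisive⇒dictator k decisive x y R x≤y with x ≟ y | T? (rel (R k) x y)
  ... | yes refl | _      = rel-refl (R k) x
  ... | no  _    | yes t  = t
  ... | no  x≢y  | no  ¬t = ⊥-elim (≡false⇒¬T (≰ (decisive (≢-sym x≢y) R y<x)) x≤y)
    where
      y<x : ∀ k′ → T (k′ ≡ᵇ k) → y <⟨ R k′ ⟩ x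
      y<x k′ e rewrite ≡ᵇ⇒≡ k′ k e = mk< (¬T⇒≡false ¬t)

  arrow : Σ ℕ (λ k → T (k ∈ᵇ ks) × Dictator G k)
  arrow with decisive-singleton ks (λ _ k∈ks → k∈ks) decisive-ks
  ... | k , k∈ks , decisive = k , k∈ks , decisive⇒dictator k decisive

-- Wilson's theorem

WilsonOutcome : ∀ {S} → List ℕ → SWF S ℕ → Set
WilsonOutcome ks G = Null G ⊎ Σ ℕ (λ k → T (k ∈ᵇ ks) × (Dictator G k ⊎ Dictator (reverseSWF G) k))

module Wilson {S : Set} (_≟_ : DecidableEquality S) {a b c : S} (a≢b : a ≢ b) (a≢c : a ≢ c) (b≢c : b ≢ c)
  (ks : List ℕ) (G : SWF S ℕ) (iia : IIAOn ks G) (cs : CS G) where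
  open Profiles _≟_
  open ≡-Reasoning

  iia-all : ∀ {x y} ρ σ → (∀ k → Agree x y (ρ k) (σ k)) → Agree x y (G ρ) (G σ)
  iia-all = iiaOn-all {ks = ks} iia

  bottomOutcome : S → Pref S
  bottomOutcome x = G (λ _ → bottom x)

  module Below {x y z : S} (x≢y : x ≢ y) (x≢z : x ≢ z) (y≢z : y ≢ z) (σ : Config S ℕ) where
    private module P (k : ℕ) = Placed x≢y x≢z y≢z (σ k)

    profile : Config S ℕ
    profile k = below x y z (σ k)

    at-xy : Agree x y (G profile) (bottomOutcome x)
    at-xy = iia-all _ _ (λ k → <-agree (P.below-<₁ k) (bottom-< x≢y))
    at-xz : Agree x z (G profile) (bottomOutcome x)
    at-xz = iia-all _ _ (λ k → <-agree (P.below-<₂ k) (bottom-< x≢z))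
    at-yz : Agree y z (G profile) (G σ)
    at-yz = iia-all _ _ (λ k → P.below-agree k)

  module Above {x y z : S} (x≢y : x ≢ y) (z≢y : z ≢ y) (x≢z : x ≢ z) (σ : Config S ℕ) where
    private module P (k : ℕ) = Placed (≢-sym x≢y) (≢-sym z≢y) x≢z (σ k)

    profile : Config S ℕ
    profile k = above y x z (σ k)

    at-xy : Agree x y (G profile) (bottomOutcome x)
    at-xy = iia-all _ _ (λ k → <-agree (P.above-<₁ k) (bottom-< x≢y))
    at-zy : Agree z y (G profile) (bottomOutcome z)
    at-zy = iia-all _ _ (λ k → <-agree (P.above-<₂ k) (bottom-< z≢y))
    at-xz : Agree x z (G profile) (G σ)
    at-xz = iia-all _ _ (λ k → P.above-agree k)

  -- Whether y ≤ x when every voter puts x lowest.  It is the same for all pairs, so unless G is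
  -- null, G or its reverse satisfies Pareto.
  sign : S → S → Bool
  sign x y = rel (bottomOutcome x) y x

  sign-first : ∀ {x y z} → x ≢ y → x ≢ z → y ≢ z → T (sign x y) → T (sign x z)
  sign-first {x} {y} {z} x≢y x≢z y≢z y≤x =
    agree-transport (agree-swap (agree-sym B.at-xz))
      (trans (G B.profile) z y x (agree-transport (agree-swap B.at-yz) z≤y)
                                 (agree-transport (agree-swap B.at-xy) y≤x))
    where
      z≤y = proj₂ (proj₁ (cs z y))
      module B = Below x≢y x≢z y≢z (proj₁ (proj₁ (cs z y)))

  sign-second : ∀ {x y z} → x ≢ y → z ≢ y → x ≢ z → T (sign x y) → T (sign z y)
  sign-second {x} {y} {z} x≢y z≢y x≢z y≤x =
    agree-transport (agree-swap (agree-sym A.at-zy))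
      (trans (G A.profile) y x z (agree-transport (agree-swap A.at-xy) y≤x)
                                 (agree-transport A.at-xz x≤z))
    where
      x≤z = proj₂ (proj₁ (cs x z))
      module A = Above x≢y z≢y x≢z (proj₁ (proj₁ (cs x z)))

  sign-≡-first : ∀ {x y z} → x ≢ y → x ≢ z → y ≢ z → sign x y ≡ sign x z
  sign-≡-first x≢y x≢z y≢z = T-injective (sign-first x≢y x≢z y≢z) (sign-first x≢z x≢y (≢-sym y≢z))

  sign-≡-second : ∀ {x y z} → x ≢ y → z ≢ y → x ≢ z → sign x y ≡ sign z y
  sign-≡-second x≢y z≢y x≢z = T-injective (sign-second x≢y z≢y x≢z) (sign-second z≢y x≢y (≢-sym x≢z))

  sign-constant : ∀ {x y} → x ≢ y → sign x y ≡ sign a b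
  sign-constant {x} {y} x≢y with y ≟ a | x ≟ b | y ≟ b | x ≟ a
  ... | yes refl | yes refl | _ | _ =
    ≡-trans (sign-≡-first (≢-sym a≢b) (b≢c) a≢c)
            (≡-trans (sign-≡-second b≢c a≢c (≢-sym a≢b)) (sign-≡-first a≢c a≢b (≢-sym b≢c)))
  ... | yes refl | no x≢b | _ | _ =
    ≡-trans (sign-≡-first x≢y x≢b a≢b) (sign-≡-second x≢b a≢b (λ x≡a → x≢y x≡a))
  ... | no y≢a | _ | yes refl | yes refl = refl
  ... | no y≢a | _ | yes refl | no x≢a = sym (sign-≡-second a≢b x≢y (≢-sym x≢a))
  ... | no y≢a | _ | no y≢b | yes refl = sym (sign-≡-first a≢b (≢-sym y≢a) (≢-sym y≢b))
  ... | no y≢a | _ | no y≢b | no x≢a =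
    sym (≡-trans (sign-≡-first a≢b (≢-sym y≢a) (≢-sym y≢b)) (sign-≡-second (≢-sym y≢a) x≢y (≢-sym x≢a)))

  Tied : S → S → Set
  Tied x y = ∀ ρ → Indifferent (G ρ) x y

  forced : ∀ {x y} (v : Bool) → (∀ ρ → rel (G ρ) x y ≡ v) → ∀ ρ → rel (G ρ) x y ≡ true
  forced {x} {y} v constant ρ =
    ≡-trans (constant ρ) (≡-trans (sym (constant (proj₁ (proj₁ (cs x y))))) (T⇒≡true (proj₂ (proj₁ (cs x y)))))

  tie-spreads-first : ∀ {x y z} → x ≢ y → z ≢ x → z ≢ y → Indifferent (bottomOutcome x) x y → Tied x z
  tie-spreads-first {x} {y} {z} x≢y z≢x z≢y tie ρ = forced _ at-xz ρ , forced _ at-zx ρ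
    where
      module A (σ : Config S ℕ) = Above x≢y z≢y (≢-sym z≢x) σ
      tie′ : ∀ σ → Indifferent (G (A.profile σ)) x y
      tie′ σ = indifferent-agree (A.at-xy σ) tie
      at-xz : ∀ σ → rel (G σ) x z ≡ rel (bottomOutcome z) y z
      at-xz σ = begin
        rel (G σ) x z               ≡⟨ sym (≡xy (A.at-xz σ)) ⟩
        rel (G (A.profile σ)) x z   ≡⟨ indifferent-left (G (A.profile σ)) z (tie′ σ) ⟩
        rel (G (A.profile σ)) y z   ≡⟨ ≡yx (A.at-zy σ) ⟩
        rel (bottomOutcome z) y z   ∎
      at-zx : ∀ σ → rel (G σ) z x ≡ rel (bottomOutcome z) z y
      at-zx σ = begin
        rel (G σ) z x               ≡⟨ sym (≡yx (A.at-xz σ)) ⟩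
        rel (G (A.profile σ)) z x   ≡⟨ indifferent-right (G (A.profile σ)) z (tie′ σ) ⟩
        rel (G (A.profile σ)) z y   ≡⟨ ≡xy (A.at-zy σ) ⟩
        rel (bottomOutcome z) z y   ∎

  tie-spreads-second : ∀ {x y z} → x ≢ y → z ≢ x → z ≢ y → Indifferent (bottomOutcome x) x y → Tied y z
  tie-spreads-second {x} {y} {z} x≢y z≢x z≢y tie ρ = forced _ at-yz ρ , forced _ at-zy ρ
    where
      module B (σ : Config S ℕ) = Below x≢y (≢-sym z≢x) (≢-sym z≢y) σ
      tie′ : ∀ σ → Indifferent (G (B.profile σ)) x y
      tie′ σ = indifferent-agree (B.at-xy σ) tie
      at-yz : ∀ σ → rel (G σ) y z ≡ rel (bottomOutcome x) x z
      at-yz σ = begin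
        rel (G σ) y z               ≡⟨ sym (≡xy (B.at-yz σ)) ⟩
        rel (G (B.profile σ)) y z   ≡⟨ sym (indifferent-left (G (B.profile σ)) z (tie′ σ)) ⟩
        rel (G (B.profile σ)) x z   ≡⟨ ≡xy (B.at-xz σ) ⟩
        rel (bottomOutcome x) x z   ∎
      at-zy : ∀ σ → rel (G σ) z y ≡ rel (bottomOutcome x) z x
      at-zy σ = begin
        rel (G σ) z y               ≡⟨ sym (≡yx (B.at-yz σ)) ⟩
        rel (G (B.profile σ)) z y   ≡⟨ sym (indifferent-right (G (B.profile σ)) z (tie′ σ)) ⟩
        rel (G (B.profile σ)) z x   ≡⟨ ≡yx (B.at-xz σ) ⟩
        rel (bottomOutcome x) z x   ∎

  tied-sym : ∀ {x y} → Tied x y → Tied y x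
  tied-sym tied ρ = proj₂ (tied ρ) , proj₁ (tied ρ)

  tied-everywhere : ∀ {x₀ y₀} → x₀ ≢ y₀ → Tied x₀ y₀ → ∀ {u w} → u ≢ w → Tied u w
  tied-everywhere {x₀} {y₀} x₀≢y₀ tied {u} {w} u≢w with u ≟ x₀ | u ≟ y₀ | w ≟ y₀ | w ≟ x₀
  ... | yes refl | _ | yes refl | _ = tied
  ... | yes refl | _ | no w≢y₀ | _ = tie-spreads-first x₀≢y₀ (≢-sym u≢w) w≢y₀ (tied _)
  ... | no _ | yes refl | _ | yes refl = tied-sym tied
  ... | no _ | yes refl | _ | no w≢x₀ = tie-spreads-second x₀≢y₀ w≢x₀ (≢-sym u≢w) (tied _)
  ... | no u≢x₀ | no u≢y₀ | _ | yes refl = tied-sym (tie-spreads-first x₀≢y₀ u≢x₀ u≢y₀ (tied _))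
  ... | no u≢x₀ | no u≢y₀ | _ | no w≢x₀ =
    tie-spreads-second (≢-sym u≢x₀) w≢x₀ (≢-sym u≢w) (tie-spreads-first x₀≢y₀ u≢x₀ u≢y₀ (tied _) _)

  tie⇒null : ∀ {x y} → x ≢ y → Indifferent (bottomOutcome x) x y → Null G
  tie⇒null {x} {y} x≢y tie ρ u w with u ≟ w | third a≢b a≢c b≢c x y
  ... | yes refl | _ = rel-refl (G ρ) u
  ... | no u≢w | _ , z≢x , z≢y =
    ≡true⇒T (proj₁ (tied-everywhere (≢-sym z≢x) (tie-spreads-first x≢y z≢x z≢y tie) u≢w ρ))

  module _ (untied : ¬ Indifferent (bottomOutcome a) a b) where
    private
      untied-everywhere : ∀ {x y} → x ≢ y → ¬ Indifferent (bottomOutcome x) x y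
      untied-everywhere x≢y tie =
        untied (T⇒≡true (tie⇒null x≢y tie _ a b) , T⇒≡true (tie⇒null x≢y tie _ b a))

    by-sign : ∀ s → sign a b ≡ s → WilsonOutcome ks G
    by-sign false e with Arrow.arrow _≟_ a≢b a≢c b≢c ks G iia pareto
      where
        pareto : ∀ {x y} → x ≢ y → x <⟨ bottomOutcome x ⟩ y
        pareto x≢y = mk< (≡-trans (sign-constant x≢y) e)
    ... | k , k∈ks , dictator = inj₂ (k , k∈ks , inj₁ dictator)
    by-sign true e with Arrow.arrow _≟_ a≢b a≢c b≢c ks (reverseSWF G) (iiaOn-reverse {ks = ks} iia) pareto
      where
        pareto : ∀ {x y} → x ≢ y → x <⟨ reverse (bottomOutcome x) ⟩ y
        pareto x≢y = mk< (¬T⇒≡false (λ x≤y → untied-everywhere x≢y (T⇒≡true x≤y , ≡-trans (sign-constant x≢y) e)))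
    ... | k , k∈ks , dictator = inj₂ (k , k∈ks , inj₂ dictator)

  wilson : WilsonOutcome ks G
  wilson with T? (rel (bottomOutcome a) a b) | T? (rel (bottomOutcome a) b a)
  ... | yes t₁ | yes t₂ = inj₁ (tie⇒null a≢b (T⇒≡true t₁ , T⇒≡true t₂))
  ... | no ¬t  | _      = by-sign (λ tie → ¬t (≡true⇒T (proj₁ tie))) _ refl
  ... | yes _  | no ¬t  = by-sign (λ tie → ¬t (≡true⇒T (proj₂ tie))) _ refl

IIA⇒agree : ∀ {S V} {f : SWF S V} → IIA f →
            ∀ {x y} (P Q : Config S V) → (∀ v → Agree x y (P v) (Q v)) → Agree x y (f P) (f Q)
IIA⇒agree iia P Q agree = proj₁ eqs , proj₂ eqs
  where eqs = iia _ _ P Q (λ v → ≡xy (agree v) , ≡yx (agree v))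

agree⇒IIA : ∀ {S V} {f : SWF S V} →
            (∀ x y (P Q : Config S V) → (∀ v → Agree x y (P v) (Q v)) → Agree x y (f P) (f Q)) → IIA f
agree⇒IIA iia x y P Q eqs = ≡xy agree , ≡yx agree
  where agree = iia x y P Q (λ v → proj₁ (eqs v) , proj₂ (eqs v))

-- Keys need not be injective: an element of V ∖ i carries a proof of ≢, so V ∖ i has no decidable
-- equality and distinct voters may share a key.  Each listed key has a representative voter.
record KeyedVoters (V : Set) : Set where
  field
    keys      : List ℕ
    key       : V → ℕ
    voter     : (k : ℕ) → T (k ∈ᵇ keys) → V
    key-voter : ∀ k p → key (voter k p) ≡ k
open KeyedVoters public

module _ {S V : Set} (κ : KeyedVoters V) where

  toKeys : Config S V → Config S ℕ
  toKeys R k with T? (k ∈ᵇ keys κ)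
  ... | yes p = R (voter κ k p)
  ... | no  _ = indifference

  toKeys-∈ : ∀ R k (p : T (k ∈ᵇ keys κ)) → toKeys R k ≡ R (voter κ k p)
  toKeys-∈ R k p with T? (k ∈ᵇ keys κ)
  ... | yes p′ = cong (R ∘ voter κ k) (T-irrelevant p′ p)
  ... | no ¬p  = ⊥-elim (¬p p)

  liftSWF : SWF S ℕ → SWF S V
  liftSWF G R = G (toKeys R)

  lift-agree : ∀ {G} → IIAOn (keys κ) G → ∀ {x y} (R R′ : Config S V) →
               (∀ k p → Agree x y (R (voter κ k p)) (R′ (voter κ k p))) → Agree x y (liftSWF G R) (liftSWF G R′)
  lift-agree iia {x} {y} R R′ agree = iia x y _ _ λ k p →
    subst₂ (Agree x y) (sym (toKeys-∈ R k p)) (sym (toKeys-∈ R′ k p)) (agree k p)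

remove : ℕ → List ℕ → List ℕ
remove k [] = []
remove k (m ∷ ms) with m ≟ℕ k
... | yes _ = remove k ms
... | no  _ = m ∷ remove k ms

∈ᵇ-remove⁻ : ∀ k k′ ms → T (k′ ∈ᵇ remove k ms) → T (k′ ∈ᵇ ms) × k′ ≢ k
∈ᵇ-remove⁻ k k′ (m ∷ ms) t with m ≟ℕ k
... | yes _ = ∈ᵇ-there k′ m ms (proj₁ (∈ᵇ-remove⁻ k k′ ms t)) , proj₂ (∈ᵇ-remove⁻ k k′ ms t)
... | no m≢k with ∈ᵇ-∷ k′ m (remove k ms) t
...   | inj₁ refl = ∈ᵇ-here k′ ms , m≢k
...   | inj₂ t′   = ∈ᵇ-there k′ m ms (proj₁ (∈ᵇ-remove⁻ k k′ ms t′)) , proj₂ (∈ᵇ-remove⁻ k k′ ms t′)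

∈ᵇ-remove⁺ : ∀ k k′ ms → T (k′ ∈ᵇ ms) → k′ ≢ k → T (k′ ∈ᵇ remove k ms)
∈ᵇ-remove⁺ k k′ (m ∷ ms) t k′≢k with m ≟ℕ k | ∈ᵇ-∷ k′ m ms t
... | yes refl | inj₁ refl = ⊥-elim (k′≢k refl)
... | yes refl | inj₂ t′   = ∈ᵇ-remove⁺ m k′ ms t′ k′≢k
... | no _     | inj₁ refl = ∈ᵇ-here k′ (remove k ms)
... | no _     | inj₂ t′   = ∈ᵇ-there k′ m (remove k ms) (∈ᵇ-remove⁺ k k′ ms t′ k′≢k)

length-remove-≤ : ∀ k ms → length (remove k ms) ≤ length ms
length-remove-≤ k [] = z≤n
length-remove-≤ k (m ∷ ms) with m ≟ℕ k
... | yes _ = m≤n⇒m≤1+n (length-remove-≤ k ms)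
... | no  _ = s≤s (length-remove-≤ k ms)

length-remove-< : ∀ k ms → T (k ∈ᵇ ms) → length (remove k ms) < length ms
length-remove-< k (m ∷ ms) t with m ≟ℕ k | ∈ᵇ-∷ k m ms t
... | yes _   | _         = s≤s (length-remove-≤ k ms)
... | no m≢k  | inj₁ refl = ⊥-elim (m≢k refl)
... | no _    | inj₂ t′   = s≤s (length-remove-< k ms t′)

_without_ : ∀ {V} → KeyedVoters V → (j : V) → KeyedVoters (V ∖ j)
keys      (κ without j) = remove (key κ j) (keys κ)
key       (κ without j) v = key κ (proj₁ v)
voter     (κ without j) k p = voter κ k k∈ , λ voter≡j → k≢kⱼ (≡-trans (sym (key-voter κ k k∈)) (cong (key κ) voter≡j))
  where
    k∈  = proj₁ (∈ᵇ-remove⁻ (key κ j) k (keys κ) p)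
    k≢kⱼ = proj₂ (∈ᵇ-remove⁻ (key κ j) k (keys κ) p)
key-voter (κ without j) k p = key-voter κ k _

module Deferral {A V : Set} (κ : KeyedVoters V) (H : SWF A ℕ) (iia : IIAOn (keys κ) H) (j : V) where

  private
    kⱼ : ℕ
    kⱼ = key κ j

  F : SWF A V
  F = liftSWF κ H

  H∖j : SWF A ℕ
  H∖j ρ = H (λ k → if k ≡ᵇ kⱼ then indifference else ρ k)

  iia∖j : IIAOn (keys (κ without j)) H∖j
  iia∖j x y ρ σ agree = iia x y _ _ per-key
    where
      per-key : ∀ k → T (k ∈ᵇ keys κ) →
                Agree x y (if k ≡ᵇ kⱼ then indifference else ρ k) (if k ≡ᵇ kⱼ then indifference else σ k)
      per-key k p with k ≡ᵇ kⱼ in e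
      ... | true  = agree-refl
      ... | false = agree k (∈ᵇ-remove⁺ kⱼ k (keys κ) p (≡ᵇ-false⇒≢ e))

  deferred : SWF A (V ∖ j)
  deferred = liftSWF (κ without j) H∖j

  defers-if-representatives-indifferent : ∀ R {a b} → (∀ p → Indifferent (R (voter κ kⱼ p)) a b) →
                                          rel (F R) a b ≡ rel (deferred (drop j R)) a b
  defers-if-representatives-indifferent R {a} {b} indifferent = ≡xy (iia a b _ _ per-key)
    where
      per-key : ∀ k → T (k ∈ᵇ keys κ) →
                Agree a b (toKeys κ R k) (if k ≡ᵇ kⱼ then indifference else toKeys (κ without j) (drop j R) k)
      per-key k p with k ≡ᵇ kⱼ in e
      ... | true rewrite ≡ᵇ⇒≡ k kⱼ (≡true⇒T e) =
        subst (λ P → Agree a b P indifference) (sym (toKeys-∈ κ R kⱼ p)) (indifferent⇒agree (indifferent p))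
      ... | false = agree-≡ (≡-trans (toKeys-∈ κ R k p) (sym (≡-trans (toKeys-∈ (κ without j) (drop j R) k p′)
                                                                   (cong (R ∘ voter κ k) (T-irrelevant _ p)))))
        where p′ = ∈ᵇ-remove⁺ kⱼ k (keys κ) p (≡ᵇ-false⇒≢ e)

  override : (V → Pref A) → Config A V → Config A V
  override R′ R v = if key κ v ≡ᵇ kⱼ then R′ v else R v

  override-hit : ∀ R′ R v → key κ v ≡ kⱼ → override R′ R v ≡ R′ v
  override-hit R′ R v e rewrite e | T⇒≡true (≡ᵇ-refl kⱼ) = refl

  override-miss : ∀ R′ R v → key κ v ≢ kⱼ → override R′ R v ≡ R v
  override-miss R′ R v ne with key κ v ≡ᵇ kⱼ in e
  ... | true  = ⊥-elim (ne (≡ᵇ⇒≡ _ _ (≡true⇒T e)))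
  ... | false = refl

  module Representative (dictator : Dictator F j) (kⱼ∈ : T (kⱼ ∈ᵇ keys κ)) where

    c : V
    c = voter κ kⱼ kⱼ∈

    -- Among the voters with key kⱼ, F only looks at c.
    representative-dictator : Dictator F c
    representative-dictator x y R x≤y =
      subst (λ P → T (rel P x y)) (override-hit (λ _ → R c) R j refl) (dictator x y R♯ (agree-transport same x≤y))
      where
        R♯ : Config A V
        R♯ = override (λ _ → R c) R
        same-voter : ∀ k p → R♯ (voter κ k p) ≡ R (voter κ k p)
        same-voter k p with k ≟ℕ kⱼ
        ... | yes refl = ≡-trans (override-hit (λ _ → R c) R _ (key-voter κ kⱼ p)) (cong (R ∘ voter κ kⱼ) (T-irrelevant kⱼ∈ p))
        ... | no k≢kⱼ  = override-miss (λ _ → R c) R _ (λ e → k≢kⱼ (≡-trans (sym (key-voter κ k p)) e))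
        same : Agree x y (F R♯) (F R)
        same = lift-agree κ iia R♯ R (λ k p → agree-≡ (same-voter k p))

    -- If c did not tie a and b, replacing j's tie by the reverse of c's order would make F follow both.
    indifferent-representative : ∀ R {a b} → Indifferent (R j) a b → Indifferent (R c) a b
    indifferent-representative R {a} {b} tieⱼ with T? (rel (R c) a b ∧ rel (R c) b a)
    ... | yes tie = T⇒≡true (proj₁ (Equivalence.to T-∧ tie)) , T⇒≡true (proj₂ (Equivalence.to T-∧ tie))
    ... | no ¬tie = ⊥-elim (¬tie (Equivalence.from T-∧ both))
      where
        R′ : Config A V
        R′ = override (λ v → if rel (R v) a b ∧ rel (R v) b a then reverse (R c) else R v) R
        R′-j : R′ j ≡ reverse (R c)
        R′-j rewrite override-hit (λ v → if rel (R v) a b ∧ rel (R v) b a then reverse (R c) else R v) R j refl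
                   | proj₁ tieⱼ | proj₂ tieⱼ = refl
        R′-c : R′ c ≡ R c
        R′-c rewrite override-hit (λ v → if rel (R v) a b ∧ rel (R v) b a then reverse (R c) else R v) R c (key-voter κ kⱼ kⱼ∈)
                   | ¬T⇒≡false ¬tie = refl
        follow-j : ∀ u w → T (rel (F R′) u w) → T (rel (R c) w u)
        follow-j u w t = subst (λ P → T (rel P u w)) R′-j (dictator u w R′ t)
        follow-c : ∀ u w → T (rel (F R′) u w) → T (rel (R c) u w)
        follow-c u w t = subst (λ P → T (rel P u w)) R′-c (representative-dictator u w R′ t)
        both : T (rel (R c) a b) × T (rel (R c) b a)
        both with total (F R′) a b
        ... | inj₁ t = follow-c a b t , follow-j a b t
        ... | inj₂ t = follow-j b a t , follow-c b a t

    defers : Defers F j deferred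
    defers x y R t₁ t₂ = defers-if-representatives-indifferent R λ p →
      subst (λ q → Indifferent (R (voter κ kⱼ q)) x y) (T-irrelevant kⱼ∈ p)
            (indifferent-representative R (T⇒≡true t₁ , T⇒≡true t₂))

  -- Without a voter of key kⱼ, F ignores j entirely.
  no-key : Dictator F j → ¬ T (kⱼ ∈ᵇ keys κ) → ∀ {u w} → T (rel (F (λ _ → indifference)) u w) →
           ∀ X → T (rel X u w)
  no-key dictator kⱼ∉ {u} {w} t X =
    subst (λ P → T (rel P u w)) (override-hit (λ _ → X) _ j refl) (dictator u w R (agree-transport ignored t))
    where
      R : Config A V
      R = override (λ _ → X) (λ _ → indifference)
      ignored : Agree u w (F R) (F (λ _ → indifference))
      ignored = lift-agree κ iia R _ λ k p → agree-≡ (override-miss _ _ _ λ e →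
        kⱼ∉ (subst (λ m → T (m ∈ᵇ keys κ)) (≡-trans (sym (key-voter κ k p)) e) p))

module _ {A V : Set} (κ : KeyedVoters V) (H : SWF A ℕ) (iia : IIAOn (keys κ) H) (j : V) where
  open Deferral κ H iia j using (F; deferred)

  deferral : Dictatorial F j → T (key κ j ∈ᵇ keys κ) → Defers F j deferred
  deferral (inj₁ dictator) kⱼ∈ = Deferral.Representative.defers κ H iia j dictator kⱼ∈
  deferral (inj₂ dictator) kⱼ∈ x y R t₁ t₂ =
    Deferral.Representative.defers κ (reverseSWF H) (iiaOn-reverse {ks = keys κ} iia) j
      (λ u w R′ t → dictator w u R′ t) kⱼ∈ y x R t₂ t₁

  dictator-has-key : DecidableEquality A → ∀ {a b : A} → a ≢ b → Dictatorial F j → T (key κ j ∈ᵇ keys κ)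
  dictator-has-key _≟_ {a} {b} a≢b dictatorial with T? (key κ j ∈ᵇ keys κ)
  ... | yes kⱼ∈ = kⱼ∈
  ... | no kⱼ∉ with dictatorial | total (F (λ _ → indifference)) a b
  ...   | inj₁ d | inj₁ t = ⊥-elim (Profiles.some-pref-disagrees _≟_ a≢b (Deferral.no-key κ H iia j d kⱼ∉ t))
  ...   | inj₁ d | inj₂ t = ⊥-elim (Profiles.some-pref-disagrees _≟_ (≢-sym a≢b) (Deferral.no-key κ H iia j d kⱼ∉ t))
  ...   | inj₂ d | inj₁ t = ⊥-elim (Profiles.some-pref-disagrees _≟_ (≢-sym a≢b) (Deferral.no-key κ (reverseSWF H) (iiaOn-reverse {ks = keys κ} iia) j (λ u w R t → d w u R t) kⱼ∉ t))
  ...   | inj₂ d | inj₂ t = ⊥-elim (Profiles.some-pref-disagrees _≟_ a≢b (Deferral.no-key κ (reverseSWF H) (iiaOn-reverse {ks = keys κ} iia) j (λ u w R t → d w u R t) kⱼ∉ t))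

record Finite (S : Set) : Set where
  field
    elements : List S
    complete : ∀ s → s ∈ elements
    decEq    : DecidableEquality S

module _ {S : Set} (fin : Finite S) where
  open Finite fin
  open import Data.List.Membership.DecPropositional decEq using (_∈?_)

  escape : (p : S → Bool) (xs : List S) → Σ S (λ z → T (p z) × z ∉ xs) ⊎ (∀ z → T (p z) → z ∈ xs)
  escape p xs with any? (λ z → T? (p z) ×-dec ¬? (z ∈? xs)) elements
  ... | yes found = inj₁ (satisfied found)
  ... | no  none  = inj₂ λ z pz → decidable-stable (z ∈? xs) λ z∉xs → none (lose (complete z) (pz , z∉xs))

sub-≡ : ∀ {S} {p : S → Bool} {a b : Sub p} → proj₁ a ≡ proj₁ b → a ≡ b
sub-≡ {a = x , t} {.x , t′} refl = cong (x ,_) (T-irrelevant t t′)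

module _ {S : Set} (p : S → Bool) where
  subElements : List S → List (Sub p)
  subElements [] = []
  subElements (s ∷ ss) with T? (p s)
  ... | yes t = (s , t) ∷ subElements ss
  ... | no  _ = subElements ss

  ∈-subElements : ∀ ss s (t : T (p s)) → s ∈ ss → (s , t) ∈ subElements ss
  ∈-subElements (s′ ∷ ss) s t (here refl) with T? (p s′)
  ... | yes t′ = here (sub-≡ refl)
  ... | no ¬t  = ⊥-elim (¬t t)
  ∈-subElements (s′ ∷ ss) s t (there s∈) with T? (p s′)
  ... | yes _ = there (∈-subElements ss s t s∈)
  ... | no  _ = ∈-subElements ss s t s∈

sub-finite : ∀ {S} → Finite S → (p : S → Bool) → Finite (Sub p)
Finite.elements (sub-finite fin p) = subElements p (Finite.elements fin)
Finite.complete (sub-finite fin p) (s , t) = ∈-subElements p _ s t (Finite.complete fin s)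
Finite.decEq    (sub-finite fin p) = ×-≡-dec (Finite.decEq fin) (λ t t′ → yes (T-irrelevant t t′))

data Size {S : Set} (p : S → Bool) (x₀ : S) : Set where
  one   : (∀ y → T (p y) → y ≡ x₀) → Size p x₀
  two   : ∀ y → T (p y) → y ≢ x₀ → (∀ z → T (p z) → z ≡ x₀ ⊎ z ≡ y) → Size p x₀
  three : ∀ y z → T (p y) → T (p z) → y ≢ x₀ → z ≢ x₀ → z ≢ y → Size p x₀

size : ∀ {S} → Finite S → (p : S → Bool) (x₀ : S) → Size p x₀
size fin p x₀ with escape fin p (x₀ ∷ [])
... | inj₂ within = one λ y py → ∈-singleton (within y py)
  where
    ∈-singleton : ∀ {y} → y ∈ x₀ ∷ [] → y ≡ x₀
    ∈-singleton (here e) = e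
... | inj₁ (y , py , y∉) with escape fin p (x₀ ∷ y ∷ [])
...   | inj₁ (z , pz , z∉) = three y z py pz (λ e → y∉ (here e)) (λ e → z∉ (here e)) (λ e → z∉ (there (here e)))
...   | inj₂ within = two y py (λ e → y∉ (here e)) λ z pz → ∈-pair (within z pz)
  where
    ∈-pair : ∀ {z} → z ∈ x₀ ∷ y ∷ [] → z ≡ x₀ ⊎ z ≡ y
    ∈-pair (here e)         = inj₁ e
    ∈-pair (there (here e)) = inj₂ e

-- Searching the pairwise patterns of finitely many voters

Pattern : Set
Pattern = ℕ → Bool × Bool

options : List (Bool × Bool)
options = (true , true) ∷ (true , false) ∷ (false , true) ∷ (false , false) ∷ []

∈-options : ∀ o → o ∈ options
∈-options (true  , true)  = here refl
∈-options (true  , false) = there (here refl)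
∈-options (false , true)  = there (there (here refl))
∈-options (false , false) = there (there (there (here refl)))

_[_≔ₚ_] : Pattern → ℕ → Bool × Bool → Pattern
(α [ k ≔ₚ o ]) m = if m ≡ᵇ k then o else α m

-- Some pattern that agrees with α outside ks satisfies F.
possible : List ℕ → (Pattern → Bool) → Pattern → Bool
possible []       F α = F α
possible (k ∷ ks) F α = any (λ o → possible ks F (α [ k ≔ₚ o ])) options

possible-sound : ∀ ks F α → T (possible ks F α) → Σ Pattern (λ β → T (F β))
possible-sound []       F α t = α , t
possible-sound (k ∷ ks) F α t with satisfied (any⁻ (λ o → possible ks F (α [ k ≔ₚ o ])) options t)
... | o , t′ = possible-sound ks F (α [ k ≔ₚ o ]) t′

overlay : Pattern → List ℕ → Pattern → Pattern
overlay β []       α = α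
overlay β (k ∷ ks) α = overlay β ks (α [ k ≔ₚ β k ])

possible-complete : ∀ β ks F α → T (F (overlay β ks α)) → T (possible ks F α)
possible-complete β []       F α t = t
possible-complete β (k ∷ ks) F α t = any⁺ (λ o → possible ks F (α [ k ≔ₚ o ])) (lose (∈-options (β k)) (possible-complete β ks F _ t))

overlay-∉ : ∀ β ks α m → ¬ T (m ∈ᵇ ks) → overlay β ks α m ≡ α m
overlay-∉ β []       α m _   = refl
overlay-∉ β (k ∷ ks) α m m∉ with m ≡ᵇ k in e
... | true  = ⊥-elim (m∉ tt)
... | false = ≡-trans (overlay-∉ β ks _ m m∉) (cong (λ b → if b then β k else α m) e)

overlay-∈ : ∀ β ks α m → T (m ∈ᵇ ks) → overlay β ks α m ≡ β m
overlay-∈ β (k ∷ ks) α m m∈ with T? (m ∈ᵇ ks) | ∈ᵇ-∷ m k ks m∈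
... | yes m∈ks | _         = overlay-∈ β ks _ m m∈ks
... | no  m∉ks | inj₂ m∈ks = ⊥-elim (m∉ks m∈ks)
... | no  m∉ks | inj₁ refl = ≡-trans (overlay-∉ β ks _ m m∉ks) (cong (λ b → if b then β m else α m) (T⇒≡true (≡ᵇ-refl m)))

-- The cleric: x is weakly below y in some outcome

module Cleric {S : Set} (_≟_ : DecidableEquality S) (ks : List ℕ) (G : SWF S ℕ) (iia : IIAOn ks G) where
  open Profiles _≟_

  realize : S → S → Bool × Bool → Pref S
  realize x y (b₁ , b₂) = rank ((((λ _ → 0) [ y ≔ (if b₂ then 0 else 1) ]) [ x ≔ (if b₁ then 0 else 1) ]))

  realize-agree : ∀ x y P → Agree x y (realize x y (rel P x y , rel P y x)) P
  realize-agree x y P with x ≟ y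
  ... | yes refl = agree-diag _ P
  ... | no x≢y = ≡-trans (rel-rank r x y r-x r-y) (pairRank-≤ᵇ 0 P x y)
               , ≡-trans (rel-rank r y x r-y r-x) (pairRank-≤ᵇ 0 P y x)
    where
      r : S → ℕ
      r = ((λ _ → 0) [ y ≔ pairRank 0 P y x ]) [ x ≔ pairRank 0 P x y ]
      r-x : r x ≡ pairRank 0 P x y
      r-x = ≔-hit _ x _
      r-y : r y ≡ pairRank 0 P y x
      r-y = ≡-trans (≔-miss _ _ (≢-sym x≢y)) (≔-hit _ y _)

  possible≤ : S → S → Bool
  possible≤ x y = possible ks (λ β → rel (G (realize x y ∘ β)) x y) (λ _ → true , true)

  possible≤-sound : ∀ x y → T (possible≤ x y) → Σ (Config S ℕ) (λ ρ → T (rel (G ρ) x y))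
  possible≤-sound x y t with possible-sound ks (λ β → rel (G (realize x y ∘ β)) x y) _ t
  ... | β , x≤y = realize x y ∘ β , x≤y

  possible≤-complete : ∀ x y ρ → T (rel (G ρ) x y) → T (possible≤ x y)
  possible≤-complete x y ρ x≤y =
    possible-complete β ks (λ β′ → rel (G (realize x y ∘ β′)) x y) _ (agree-transport same x≤y)
    where
      β : Pattern
      β k = rel (ρ k) x y , rel (ρ k) y x
      same : Agree x y (G (realize x y ∘ overlay β ks (λ _ → true , true))) (G ρ)
      same = iia x y _ _ λ k k∈ →
        subst (λ o → Agree x y (realize x y o) (ρ k)) (sym (overlay-∈ β ks _ k k∈)) (realize-agree x y (ρ k))

  possible≤-refl : ∀ x → T (possible≤ x x)
  possible≤-refl x = possible≤-complete x x (λ _ → indifference) (rel-refl (G (λ _ → indifference)) x)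

  -- The rank of u relative to y, which sits at 1.
  rankAround : Pref S → S → S → ℕ
  rankAround P u y = if rel P u y then (if rel P y u then 1 else 0) else 2

  rankAround-agree : ∀ P u y → ((rankAround P u y ≤ᵇ 1) ≡ rel P u y) × ((1 ≤ᵇ rankAround P u y) ≡ rel P y u)
  rankAround-agree P u y with rel P u y | rel P y u | total P u y
  ... | true  | true  | _ = refl , refl
  ... | true  | false | _ = refl , refl
  ... | false | true  | _ = refl , refl
  ... | false | false | inj₁ ()
  ... | false | false | inj₂ ()

  possible≤-trans : ∀ x y z → T (possible≤ x y) → T (possible≤ y z) → T (possible≤ x z)
  possible≤-trans x y z xy yz with x ≟ y | y ≟ z | x ≟ z
  ... | yes refl | _ | _ = yz
  ... | no _ | yes refl | _ = xy
  ... | no _ | no _ | yes refl = possible≤-refl x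
  ... | no x≢y | no y≢z | no x≢z =
    possible≤-complete x z ρ (trans (G ρ) x y z (agree-transport at-xy x≤y) (agree-transport (agree-swap at-zy) y≤z))
    where
      ρ₁ = proj₁ (possible≤-sound x y xy)
      x≤y = proj₂ (possible≤-sound x y xy)
      ρ₂ = proj₁ (possible≤-sound y z yz)
      y≤z = proj₂ (possible≤-sound y z yz)
      ρ : Config S ℕ
      ρ k = ranks₃ x y z (rankAround (ρ₁ k) x y) 1 (rankAround (ρ₂ k) z y)
      module R (k : ℕ) = Ranks₃ x≢y x≢z y≢z (rankAround (ρ₁ k) x y) 1 (rankAround (ρ₂ k) z y)
      at-xy : Agree x y (G ρ) (G ρ₁)
      at-xy = iia x y _ _ λ k _ → ≡-trans (R.at-xy k) (proj₁ (rankAround-agree (ρ₁ k) x y))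
                                , ≡-trans (R.at-yx k) (proj₂ (rankAround-agree (ρ₁ k) x y))
      at-zy : Agree z y (G ρ) (G ρ₂)
      at-zy = iia z y _ _ λ k _ → ≡-trans (R.at-zy k) (proj₁ (rankAround-agree (ρ₂ k) z y))
                                , ≡-trans (R.at-yz k) (proj₂ (rankAround-agree (ρ₂ k) z y))

  cleric : Pref S
  rel   cleric = possible≤
  total cleric x y with total (G (λ _ → indifference)) x y
  ... | inj₁ t = inj₁ (possible≤-complete x y _ t)
  ... | inj₂ t = inj₂ (possible≤-complete y x _ t)
  trans cleric = possible≤-trans

_≋_ : ∀ {S V} → SWF S V → SWF S V → Set
_≋_ {S} {V} f f′ = ∀ (R : Config S V) x y → Agree x y (f R) (f′ R)

≋-sym : ∀ {S V} {f f′ : SWF S V} → f ≋ f′ → f′ ≋ f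
≋-sym f≋f′ R x y = agree-sym (f≋f′ R x y)

null-≋ : ∀ {S V} {f f′ : SWF S V} → f ≋ f′ → Null f → Null f′
null-≋ f≋f′ null R x y = agree-transport (agree-sym (f≋f′ R x y)) (null R x y)

dictatorial-≋ : ∀ {S V} {f f′ : SWF S V} {j} → f ≋ f′ → Dictatorial f j → Dictatorial f′ j
dictatorial-≋ f≋f′ (inj₁ d) = inj₁ λ x y R t → d x y R (agree-transport (f≋f′ R x y) t)
dictatorial-≋ f≋f′ (inj₂ d) = inj₂ λ x y R t → d x y R (agree-transport (f≋f′ R x y) t)

defers-≋ : ∀ {S V} {f f′ : SWF S V} {j g} → f ≋ f′ → Defers f j g → Defers f′ j g
defers-≋ f≋f′ defers x y R t₁ t₂ = ≡-trans (sym (≡xy (f≋f′ R x y))) (defers x y R t₁ t₂)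

lift-outcome : ∀ {S V} (κ : KeyedVoters V) {G : SWF S ℕ} → WilsonOutcome (keys κ) G →
               Null (liftSWF κ G) ⊎ Σ V (Dictatorial (liftSWF κ G))
lift-outcome κ (inj₁ null) = inj₁ λ R → null (toKeys κ R)
lift-outcome κ (inj₂ (k , k∈ , inj₁ d)) =
  inj₂ (voter κ k k∈ , inj₁ λ x y R t → subst (λ P → T (rel P x y)) (toKeys-∈ κ R k k∈) (d x y (toKeys κ R) t))
lift-outcome κ (inj₂ (k , k∈ , inj₂ d)) =
  inj₂ (voter κ k k∈ , inj₂ λ x y R t → subst (λ P → T (rel P y x)) (toKeys-∈ κ R k k∈) (d y x (toKeys κ R) t))

module _ {S : Set} (p : S → Bool) where

  extend-restrict : ∀ (R : Pref (Sub p)) (a b : Sub p) → rel (extend p R) (proj₁ a) (proj₁ b) ≡ rel R a b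
  extend-restrict R (x , tx) (y , ty) with T? (p x) | T? (p y)
  ... | yes tx′ | yes ty′ = cong₂ (λ u w → rel R (x , u) (y , w)) (T-irrelevant tx′ tx) (T-irrelevant ty′ ty)
  ... | no ¬tx  | _       = ⊥-elim (¬tx tx)
  ... | yes _   | no ¬ty  = ⊥-elim (¬ty ty)

  extend-agree : ∀ {a b P Q} → Agree a b P Q → Agree (proj₁ a) (proj₁ b) (extend p P) (extend p Q)
  extend-agree {a} {b} {P} {Q} (e₁ , e₂) =
    ≡-trans (extend-restrict P a b) (≡-trans e₁ (sym (extend-restrict Q a b))) ,
    ≡-trans (extend-restrict P b a) (≡-trans e₂ (sym (extend-restrict Q b a)))

  restrict-agree : ∀ {a b : Sub p} {P Q} → Agree (proj₁ a) (proj₁ b) P Q → Agree a b (restrict p P) (restrict p Q)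
  restrict-agree (e₁ , e₂) = e₁ , e₂

ThreeDistinct : Set → Set
ThreeDistinct S = Σ S λ a → Σ S λ b → Σ S λ c → (a ≢ b) × (a ≢ c) × (b ≢ c)

Recursion : ∀ {V} → KeyedVoters V → Set₁
Recursion {V} κ = ∀ j → T (key κ j ∈ᵇ keys κ) → ∀ {S} → Finite S → (G : SWF S ℕ) →
                  IIAOn (keys (κ without j)) G → ClericalDictatorial S (V ∖ j) (liftSWF (κ without j) G)

module Class {S V : Set} (fin : Finite S) (κ : KeyedVoters V) (G : SWF S ℕ) (iia : IIAOn (keys κ) G) (x₀ : S) where
  open Cleric (Finite.decEq fin) (keys κ) G iia

  p : S → Bool
  p = classOf cleric x₀

  A : Set
  A = Sub p

  restricted : SWF A V
  restricted = restrictSWF (liftSWF κ G) p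

  GA : SWF A ℕ
  GA ρ = restrict p (G (λ k → extend p (ρ k)))

  iiaA : IIAOn (keys κ) GA
  iiaA a b ρ σ agree = restrict-agree p (iia (proj₁ a) (proj₁ b) _ _ λ k k∈ → extend-agree p (agree k k∈))

  in-class : ∀ (a b : A) → T (possible≤ (proj₁ a) (proj₁ b))
  in-class a b = possible≤-trans _ x₀ _ (proj₁ (Equivalence.to T-∧ (proj₂ a))) (proj₂ (Equivalence.to T-∧ (proj₂ b)))

  csA : CS GA
  csA a b = witness a b , witness b a
    where
      witness : ∀ a b → Σ (Config A ℕ) (λ ρ → T (rel (GA ρ) a b))
      witness a b = (λ k → restrict p (ρ k)) , agree-transport same a≤b
        where
          ρ = proj₁ (possible≤-sound _ _ (in-class a b))
          a≤b = proj₂ (possible≤-sound _ _ (in-class a b))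
          same : Agree (proj₁ a) (proj₁ b) (G (λ k → extend p (restrict p (ρ k)))) (G ρ)
          same = iia _ _ _ _ λ k _ → extend-restrict p (restrict p (ρ k)) a b , extend-restrict p (restrict p (ρ k)) b a

  restricted≋lifted : restricted ≋ liftSWF κ GA
  restricted≋lifted R a b = restrict-agree p (iia _ _ _ _ λ k k∈ →
    agree-≡ (≡-trans (toKeys-∈ κ (λ v → extend p (R v)) k k∈) (sym (cong (extend p) (toKeys-∈ κ R k k∈)))))

  well-defined : WellDefinedOn (liftSWF κ G) p
  well-defined P Q same a b = ≡xy (lift-agree κ iia P Q λ k _ → same (voter κ k _) a b , same (voter κ k _) b a)

  x₀∈A : A
  x₀∈A = x₀ , Equivalence.from T-∧ (possible≤-refl x₀ , possible≤-refl x₀)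

  singleton-null : (∀ y → T (p y) → y ≡ x₀) → Null restricted
  singleton-null only R a b =
    subst₂ (λ u w → T (rel X u w)) (sym (only _ (proj₂ a))) (sym (only _ (proj₂ b))) (rel-refl X x₀)
    where X = liftSWF κ G (λ v → extend p (R v))

  classify : Size p x₀ → Null restricted ⊎ Σ V (Dictatorial restricted) ⊎ ExactlyTwo A
  classify (one only) = inj₁ (singleton-null only)
  classify (two y py y≢x₀ within) =
    inj₂ (inj₂ (x₀∈A , (y , py) , (λ e → y≢x₀ (sym (cong proj₁ e))) , λ c → map-⊎ sub-≡ sub-≡ (within _ (proj₂ c))))
  classify (three y z py pz y≢x₀ z≢x₀ z≢y)
    with lift-outcome κ {GA} (Wilson.wilson (Finite.decEq (sub-finite fin p))
                           {x₀∈A} {y , py} {z , pz}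
                           (λ e → y≢x₀ (sym (cong proj₁ e))) (λ e → z≢x₀ (sym (cong proj₁ e))) (λ e → z≢y (sym (cong proj₁ e)))
                           (keys κ) GA iiaA csA)
  ... | inj₁ null = inj₁ (null-≋ (≋-sym restricted≋lifted) null)
  ... | inj₂ (j , d) = inj₂ (inj₁ (j , dictatorial-≋ (≋-sym restricted≋lifted) d))

  DeferredTo : V → Set₁
  DeferredTo j = Σ (SWF A (V ∖ j)) (λ g → Defers restricted j g × ClericalDictatorial A (V ∖ j) g)

  defer-distinct : Recursion κ → ∀ {a b : A} → a ≢ b → ∀ j → Dictatorial restricted j → DeferredTo j
  defer-distinct recursion a≢b j dictatorial =
    Deferral.deferred κ GA iiaA j ,
    defers-≋ {g = Deferral.deferred κ GA iiaA j} (≋-sym restricted≋lifted) (deferral κ GA iiaA j lifted kⱼ∈) ,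
    recursion j kⱼ∈ (sub-finite fin p) (Deferral.H∖j κ GA iiaA j) (Deferral.iia∖j κ GA iiaA j)
    where
      lifted = dictatorial-≋ restricted≋lifted dictatorial
      kⱼ∈ = dictator-has-key κ GA iiaA j (Finite.decEq (sub-finite fin p)) a≢b lifted

  defer : Recursion κ → Size p x₀ → ∀ j → Dictatorial restricted j → DeferredTo j
  defer _ (one only) j _ =
    (λ _ → indifference) , (λ x y R _ _ → T⇒≡true (singleton-null only R x y)) , cd-null (λ _ _ _ → tt)
  defer recursion (two y py y≢x₀ _) =
    defer-distinct recursion {x₀∈A} {y , py} (λ e → y≢x₀ (sym (cong proj₁ e)))
  defer recursion (three y _ py _ y≢x₀ _ _) =
    defer-distinct recursion {x₀∈A} {y , py} (λ e → y≢x₀ (sym (cong proj₁ e)))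

clerical-dictatorial : ∀ n {S V} → Finite S → (κ : KeyedVoters V) → length (keys κ) < n →
                       (G : SWF S ℕ) → IIAOn (keys κ) G → ClericalDictatorial S V (liftSWF κ G)
clerical-dictatorial (suc n) fin κ (s≤s len) G iia =
  cd-cleric (Cleric.cleric (Finite.decEq fin) (keys κ) G iia)
    (λ x y R → Cleric.possible≤-complete (Finite.decEq fin) (keys κ) G iia x y (toKeys κ R))
    λ x₀ → let open Class fin κ G iia x₀ in
      well-defined , classify (size fin p x₀) , defer recursion (size fin p x₀)
  where
    recursion : Recursion κ
    recursion j kⱼ∈ fin′ G′ iia′ =
      clerical-dictatorial n fin′ (κ without j) (≤-trans (length-remove-< _ (keys κ) kⱼ∈) len) G′ iia′

NullOrDeferringDictator : ∀ {S V} → SWF S V → Set₁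
NullOrDeferringDictator {S} {V} f =
  Null f ⊎ Σ V (λ i → Dictatorial f i × Σ (SWF S (V ∖ i)) (λ g → Defers f i g × ClericalDictatorial S (V ∖ i) g))

IIA-reverse : ∀ {S V} {f : SWF S V} → IIA f → IIA (reverseSWF f)
IIA-reverse iia x y P Q same = swap (iia x y P Q same)

module _ {S V : Set} where

  CS-reverse : {f : SWF S V} → CS (reverseSWF f) → CS f
  CS-reverse cs x y = swap (cs x y)

  null-IIA : {f : SWF S V} → Null f → IIA f
  null-IIA {f} null = agree⇒IIA {f = f} λ x y P Q _ →
    ≡-trans (T⇒≡true (null P x y)) (sym (T⇒≡true (null Q x y))) ,
    ≡-trans (T⇒≡true (null P y x)) (sym (T⇒≡true (null Q y x)))

  null-CS : {f : SWF S V} → Null f → CS f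
  null-CS null x y = ((λ _ → indifference) , null _ x y) , ((λ _ → indifference) , null _ y x)

  dictator-false : ∀ {f : SWF S V} {i} → Dictator f i → ∀ R {x y} → rel (R i) x y ≡ false → rel (f R) x y ≡ false
  dictator-false dictator R {x} {y} e = ¬T⇒≡false λ t → ≡false⇒¬T e (dictator x y R t)

  dictator-IIA : ∀ {f : SWF S V} {i g} → Dictator f i → Defers f i g → IIA g → IIA f
  dictator-IIA {f} {i} {g} dictator defers iia-g = agree⇒IIA {f = f} by-voter-i
    where
      by-voter-i : ∀ x y (P Q : Config S V) → (∀ v → Agree x y (P v) (Q v)) → Agree x y (f P) (f Q)
      by-voter-i x y P Q same with rel (P i) x y in e₁ | rel (P i) y x in e₂
      ... | false | _ = agree-false (f P) (f Q) x y
                          (dictator-false {f = f} dictator P e₁) (dictator-false {f = f} dictator Q (≡-trans (sym (≡xy (same i))) e₁))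
      ... | true | false = agree-swap (agree-false (f P) (f Q) y x
                          (dictator-false {f = f} dictator P e₂) (dictator-false {f = f} dictator Q (≡-trans (sym (≡yx (same i))) e₂)))
      ... | true | true =
        ≡-trans (defers x y P tP₁ tP₂) (≡-trans (≡xy g-same) (sym (defers x y Q tQ₁ tQ₂))) ,
        ≡-trans (defers y x P tP₂ tP₁) (≡-trans (≡yx g-same) (sym (defers y x Q tQ₂ tQ₁)))
        where
          tP₁ = ≡true⇒T e₁
          tP₂ = ≡true⇒T e₂
          tQ₁ = ≡true⇒T (≡-trans (sym (≡xy (same i))) e₁)
          tQ₂ = ≡true⇒T (≡-trans (sym (≡yx (same i))) e₂)
          g-same = IIA⇒agree {f = g} iia-g (drop i P) (drop i Q) (λ v → same (proj₁ v))

  dictatorial-IIA : ∀ {f : SWF S V} {i g} → Dictatorial f i → Defers f i g → IIA g → IIA f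
  dictatorial-IIA {f} {i} {g} (inj₁ d) defers iia-g = dictator-IIA {f = f} {i} {g} d defers iia-g
  dictatorial-IIA {f} {i} {g} (inj₂ d) defers iia-g =
    IIA-reverse {f = reverseSWF f}
      (dictator-IIA {f = reverseSWF f} {i} {reverseSWF g} (λ x y R t → d y x R t) (λ x y R t₁ t₂ → defers y x R t₂ t₁)
                    (IIA-reverse {f = g} iia-g))

  dictator-CS : DecidableEquality S → ∀ {f : SWF S V} {i} → Dictator f i → CS f
  dictator-CS _≟_ {f} dictator x y = above-bottom x y , above-bottom y x
    where
      open Profiles _≟_
      above-bottom : ∀ x y → Σ (Config S V) (λ P → T (rel (f P) x y))
      above-bottom x y with x ≟ y
      ... | yes refl = (λ _ → indifference) , rel-refl (f _) x
      ... | no x≢y = (λ _ → bottom x) ,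
                     rel-false⇒flip (f _) y x (dictator-false {f = f} dictator (λ _ → bottom x) (≰ (bottom-< x≢y)))

  dictatorial-CS : DecidableEquality S → ∀ {f : SWF S V} {i} → Dictatorial f i → CS f
  dictatorial-CS _≟_ {f} (inj₁ d) = dictator-CS _≟_ {f = f} d
  dictatorial-CS _≟_ {f} (inj₂ d) = CS-reverse {f = f} (dictator-CS _≟_ {f = reverseSWF f} λ x y R t → d y x R t)

¬at-most-two : ∀ {S} → ThreeDistinct S → ¬ AtMostTwo S
¬at-most-two (a , b , c , a≢b , a≢c , b≢c) atMostTwo with atMostTwo a b c
... | inj₁ a≡b        = a≢b a≡b
... | inj₂ (inj₁ b≡c) = b≢c b≡c
... | inj₂ (inj₂ a≡c) = a≢c a≡c

¬exactly-two : ∀ {S} → ThreeDistinct S → ¬ ExactlyTwo S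
¬exactly-two (a , b , c , a≢b , a≢c , b≢c) (u , w , _ , only) with only a | only b | only c
... | inj₁ refl | inj₁ refl | _         = a≢b refl
... | inj₂ refl | inj₂ refl | _         = a≢b refl
... | inj₁ refl | inj₂ refl | inj₁ refl = a≢c refl
... | inj₁ refl | inj₂ refl | inj₂ refl = b≢c refl
... | inj₂ refl | inj₁ refl | inj₁ refl = b≢c refl
... | inj₂ refl | inj₁ refl | inj₂ refl = a≢c refl

module WithinClass {S V : Set} (fin : Finite S) {g : SWF S V} (p : S → Bool) (wd : WellDefinedOn g p) where

  restriction-≡ : ∀ R (a b : Sub p) → rel (g R) (proj₁ a) (proj₁ b) ≡ rel (restrictSWF g p (λ v → restrict p (R v))) a b
  restriction-≡ R a b = wd R _ (λ v c e → sym (extend-restrict p (restrict p (R v)) c e)) a b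

  agree-via-restriction : IIA (restrictSWF g p) → ∀ (a b : Sub p) P Q →
    (∀ v → Agree (proj₁ a) (proj₁ b) (P v) (Q v)) → Agree (proj₁ a) (proj₁ b) (g P) (g Q)
  agree-via-restriction iia a b P Q same =
    ≡-trans (restriction-≡ P a b) (≡-trans (≡xy restricted) (sym (restriction-≡ Q a b))) ,
    ≡-trans (restriction-≡ P b a) (≡-trans (≡yx restricted) (sym (restriction-≡ Q b a)))
    where restricted = IIA⇒agree {f = restrictSWF g p} iia {a} {b} (λ v → restrict p (P v)) (λ v → restrict p (Q v)) λ v → restrict-agree p (same v)

  agree-on-pair-class : ∀ {x y} → T (p x) → T (p y) → (∀ z → T (p z) → z ∈ x ∷ y ∷ []) →
    ∀ P Q → (∀ v → Agree x y (P v) (Q v)) → Agree x y (g P) (g Q)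
  agree-on-pair-class {x} {y} px py within P Q same = wd P Q on-class (x , px) (y , py) , wd P Q on-class (y , py) (x , px)
    where
      on-pair : ∀ v {u w} → u ∈ x ∷ y ∷ [] → w ∈ x ∷ y ∷ [] → rel (P v) u w ≡ rel (Q v) u w
      on-pair v (here refl)         (here refl)         = ≡xy (agree-diag (P v) (Q v))
      on-pair v (here refl)         (there (here refl)) = ≡xy (same v)
      on-pair v (there (here refl)) (here refl)         = ≡yx (same v)
      on-pair v (there (here refl)) (there (here refl)) = ≡xy (agree-diag (P v) (Q v))
      on-class : ∀ v (c e : Sub p) → rel (P v) (proj₁ c) (proj₁ e) ≡ rel (Q v) (proj₁ c) (proj₁ e)
      on-class v (c , pc) (e , pe) = on-pair v (within c pc) (within e pe)

  agree-in-class : ∀ {x y} → T (p x) → T (p y) → x ≢ y → (ThreeDistinct (Sub p) → IIA (restrictSWF g p)) →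
    ∀ P Q → (∀ v → Agree x y (P v) (Q v)) → Agree x y (g P) (g Q)
  agree-in-class {x} {y} px py x≢y iia with escape fin p (x ∷ y ∷ [])
  ... | inj₂ within = agree-on-pair-class px py within
  ... | inj₁ (z , pz , z∉) =
    agree-via-restriction (iia ((x , px) , (y , py) , (z , pz) ,
      (λ e → x≢y (cong proj₁ e)) , (λ e → z∉ (here (sym (cong proj₁ e)))) , (λ e → z∉ (there (here (sym (cong proj₁ e)))))))
      (x , px) (y , py)

clerical-dictatorial-IIA : ∀ {S V} {g : SWF S V} → Finite S → ThreeDistinct S → ClericalDictatorial S V g → IIA g
clerical-dictatorial-IIA {g = g} _ _ (cd-null null) = null-IIA {f = g} null
clerical-dictatorial-IIA _ distinct (cd-small atMostTwo) = ⊥-elim (¬at-most-two distinct atMostTwo)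
clerical-dictatorial-IIA {S} {V} {g} fin _ (cd-cleric C clerical classes) = agree⇒IIA {f = g} by-cleric
  where
    by-cleric : ∀ x y (P Q : Config S V) → (∀ v → Agree x y (P v) (Q v)) → Agree x y (g P) (g Q)
    by-cleric x y P Q same with Finite.decEq fin x y | T? (rel C x y) | T? (rel C y x)
    ... | yes refl | _ | _ = agree-diag (g P) (g Q)
    ... | no _ | no x≰y | _ =
      agree-false (g P) (g Q) x y (¬T⇒≡false (x≰y ∘ clerical x y P)) (¬T⇒≡false (x≰y ∘ clerical x y Q))
    ... | no _ | yes _ | no y≰x = agree-swap
      (agree-false (g P) (g Q) y x (¬T⇒≡false (y≰x ∘ clerical y x P)) (¬T⇒≡false (y≰x ∘ clerical y x Q)))
    ... | no x≢y | yes x≤y | yes y≤x =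
      WithinClass.agree-in-class fin p (proj₁ (classes x)) px py x≢y restricted-IIA P Q same
      where
        p = classOf C x
        px = Equivalence.from T-∧ (rel-refl C x , rel-refl C x)
        py = Equivalence.from T-∧ (y≤x , x≤y)
        restricted-IIA : ThreeDistinct (Sub p) → IIA (restrictSWF g p)
        restricted-IIA distinct with proj₁ (proj₂ (classes x))
        ... | inj₁ null = null-IIA {f = restrictSWF g p} null
        ... | inj₂ (inj₂ exactlyTwo) = ⊥-elim (¬exactly-two distinct exactlyTwo)
        ... | inj₂ (inj₁ (j , d)) =
          dictatorial-IIA {f = restrictSWF g p} {j} {proj₁ (proj₂ (proj₂ (classes x)) j d)} d (proj₁ (proj₂ (proj₂ (proj₂ (classes x)) j d)))
            (clerical-dictatorial-IIA (sub-finite fin p) distinct (proj₂ (proj₂ (proj₂ (proj₂ (classes x)) j d))))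

null-or-deferring-dictator⇒IIA×CS : ∀ {S V} {f : SWF S V} → Finite S → ThreeDistinct S →
                                    NullOrDeferringDictator f → IIA f × CS f
null-or-deferring-dictator⇒IIA×CS {f = f} _ _ (inj₁ null) = null-IIA {f = f} null , null-CS {f = f} null
null-or-deferring-dictator⇒IIA×CS {f = f} fin distinct (inj₂ (i , d , g , defers , cd)) =
  dictatorial-IIA {f = f} {i} {g} d defers (clerical-dictatorial-IIA fin distinct cd) ,
  dictatorial-CS (Finite.decEq fin) {f = f} d

record Faithful {V : Set} (κ : KeyedVoters V) : Set where
  field
    key∈      : ∀ v → T (key κ v ∈ᵇ keys κ)
    voter-key : ∀ v → voter κ (key κ v) (key∈ v) ≡ v

module _ {S V : Set} (fin : Finite S) (κ : KeyedVoters V) (faithful : Faithful κ)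
         (f : SWF S V) (iia : IIA f) (cs : CS f) where
  open Faithful faithful

  private
    G₀ : SWF S ℕ
    G₀ ρ = f (λ v → ρ (key κ v))

    iia₀ : IIAOn (keys κ) G₀
    iia₀ x y ρ σ same = IIA⇒agree {f = f} iia _ _ λ v → same (key κ v) (key∈ v)

    f≋lifted : f ≋ liftSWF κ G₀
    f≋lifted R x y = IIA⇒agree {f = f} iia R _ λ v →
      agree-≡ (sym (≡-trans (toKeys-∈ κ R (key κ v) (key∈ v)) (cong R (voter-key v))))

    cs₀ : CS G₀
    cs₀ x y = witness x y , witness y x
      where
        witness : ∀ x y → Σ (Config S ℕ) (λ ρ → T (rel (G₀ ρ) x y))
        witness x y = toKeys κ (proj₁ (proj₁ (cs x y))) ,
                      agree-transport (agree-sym (f≋lifted _ x y)) (proj₂ (proj₁ (cs x y)))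

  IIA×CS⇒null-or-deferring-dictator : ThreeDistinct S → NullOrDeferringDictator f
  IIA×CS⇒null-or-deferring-dictator (a , b , c , a≢b , a≢c , b≢c)
    with lift-outcome κ {G₀} (Wilson.wilson (Finite.decEq fin) a≢b a≢c b≢c (keys κ) G₀ iia₀ cs₀)
  ... | inj₁ null = inj₁ (null-≋ (≋-sym f≋lifted) null)
  ... | inj₂ (i , d) =
    inj₂ (i , dictatorial-≋ (≋-sym f≋lifted) d , Deferral.deferred κ G₀ iia₀ i ,
          defers-≋ {g = Deferral.deferred κ G₀ iia₀ i} (≋-sym f≋lifted) (deferral κ G₀ iia₀ i d (key∈ i)) ,
          clerical-dictatorial _ fin (κ without i) ≤-refl (Deferral.H∖j κ G₀ iia₀ i) (Deferral.iia∖j κ G₀ iia₀ i))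

finite-Fin : ∀ n → Finite (Fin n)
finite-Fin n = record { elements = allFin n ; complete = ∈-allFin ; decEq = Fin._≟_ }

three-Fin : ∀ {n} → 3 ≤ n → ThreeDistinct (Fin n)
three-Fin (s≤s (s≤s (s≤s z≤n))) = zero , suc zero , suc (suc zero) , (λ ()) , (λ ()) , (λ ())

∈ᵇ-downFrom⁺ : ∀ {k} n → k < n → T (k ∈ᵇ downFrom n)
∈ᵇ-downFrom⁺ {k} (suc n) (s≤s k≤n) with k ≟ℕ n
... | yes refl = ∈ᵇ-here k (downFrom k)
... | no  k≢n  = ∈ᵇ-there k n (downFrom n) (∈ᵇ-downFrom⁺ n (≤∧≢⇒< k≤n k≢n))

∈ᵇ-downFrom⁻ : ∀ {k} n → T (k ∈ᵇ downFrom n) → k < n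
∈ᵇ-downFrom⁻ {k} (suc n) k∈ with ∈ᵇ-∷ k n (downFrom n) k∈
... | inj₁ refl = n<1+n k
... | inj₂ k∈′  = m≤n⇒m≤1+n (∈ᵇ-downFrom⁻ n k∈′)

keyed-Fin : ∀ N → KeyedVoters (Fin N)
keyed-Fin N = record
  { keys = downFrom N ; key = toℕ ; voter = λ k k∈ → fromℕ< (∈ᵇ-downFrom⁻ N k∈) ; key-voter = λ k k∈ → toℕ-fromℕ< _ }

faithful-Fin : ∀ N → Faithful (keyed-Fin N)
faithful-Fin N = record { key∈ = λ v → ∈ᵇ-downFrom⁺ N (toℕ<n v) ; voter-key = λ v → fromℕ<-toℕ v _ }

theorem5 : ∀ {n N : ℕ} → 3 ≤ n → (f : SWF (Fin n) (Fin N)) →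
    (IIA f × CS f) ⇔
    (Null f ⊎ Σ (Fin N) (λ i → Dictatorial f i × Σ (SWF (Fin n) (Fin N ∖ i)) (λ g → Defers f i g × ClericalDictatorial (Fin n) (Fin N ∖ i) g)))
theorem5 {n} {N} 3≤n f = mk⇔
  (λ (iia , cs) → IIA×CS⇒null-or-deferring-dictator (finite-Fin n) (keyed-Fin N) (faithful-Fin N) f iia cs (three-Fin 3≤n))
  (null-or-deferring-dictator⇒IIA×CS {f = f} (finite-Fin n) (three-Fin 3≤n))
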